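{- Let $q$ be a prime power and let $\mathcal{M}$ be a class of simple $GF(q)$-representable matroids that is closed under taking induced minors. Let $\widehat{\mathcal{M}}$ be the class consisting of the members of $\mathcal{M}$ together with all matroids obtainable from members of $\mathcal{M}$ by repeatedly taking $q$-conings. Then $\widehat{\mathcal{M}}$ is closed under taking contractions (each contraction followed by simplification).
   Context: An induced minor of $M$ is a matroid obtained from $M$ by a sequence of restrictions to flats and contractions (each contraction followed by simplification). For a simple $GF(q)$-representable matroid $N$ (viewed as a restriction of a projective geometry over $GF(q)$), its $q$-coning $A(N)$ is obtained by adding a coloop $p$ (the tip) to $N$ and then adding every point on each projective line between $p$ and a point of $N$. -}

module Defs where

open import Data.Nat using (ℕ; zero; suc)
import Data.Nat as ℕ
open import Data.Fin using (Fin; zero; suc; _≟_; remQuot)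
open import Data.Bool using (Bool; true; false; _∧_; _∨_; not)
open import Data.List using (allFin)
open import Data.Bool.ListAction using (any)
open import Data.Product using (Σ; _×_; _,_)
open import Data.Sum using (_⊎_)
open import Relation.Nullary using (¬_)
open import Relation.Nullary.Decidable using (isYes)
open import Relation.Binary.PropositionalEquality using (_≡_; _≢_)
open import Algebra.Structures using (IsCommutativeRing)
open import Function.Bundles using (_↔_; _⇔_; Inverse)

-- Finite fields.  q = size; a finite field GF(q) exists iff q is a prime
-- power and is then unique up to isomorphism, so quantifying over all
-- finite fields is the same as quantifying over prime powers q.

record FiniteField : Set₁ where
  infixl 6 _+_
  infixl 7 _*_
  field
    Carrier : Set
    _+_ _*_ : Carrier → Carrier → Carrier
    -_      : Carrier → Carrier
    0# 1#   : Carrier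
    isCommutativeRing : IsCommutativeRing _≡_ _+_ _*_ -_ 0# 1#
    0≢1     : 0# ≢ 1#
    inverse : ∀ x → x ≢ 0# → Σ Carrier (λ y → x * y ≡ 1#)
    size    : ℕ
    enum    : Fin size ↔ Carrier

Sub : ℕ → Set
Sub n = Fin n → Bool

_∪_ : ∀ {n} → Sub n → Sub n → Sub n
(A ∪ B) i = A i ∨ B i

⁅_⁆ : ∀ {n} → Fin n → Sub n
⁅ i ⁆ j = isYes (i ≟ j)

pair : ∀ {n} → Fin n → Fin n → Sub n
pair i j = ⁅ i ⁆ ∪ ⁅ j ⁆

_⊆_ : ∀ {n} → Sub n → Sub n → Set
A ⊆ B = ∀ i → A i ≡ true → B i ≡ true

Disjoint : ∀ {n} → Sub n → Sub n → Set
Disjoint A B = ∀ i → A i ≡ true → B i ≡ false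

image : ∀ {m n} → (Fin m → Fin n) → Sub m → Sub n
image {m} f I j = any (λ i → I i ∧ isYes (f i ≟ j)) (allFin m)

-- Abstract matroids on the ground set Fin n, given by their independence
-- predicate.  (All matroids below come from vector configurations, so the
-- matroid axioms hold automatically.)

IndSys : ℕ → Set₁
IndSys n = Sub n → Set

module _ {n : ℕ} (M : IndSys n) where

  MaxIndepIn : Sub n → Sub n → Set
  MaxIndepIn X B = B ⊆ X × M B ×
    (∀ e → X e ≡ true → B e ≡ false → ¬ M (B ∪ ⁅ e ⁆))

  -- X is a flat (closed set): adding any element outside X raises the rank,
  -- i.e. extends a (any) basis of X to a larger independent set.
  IsFlat : Sub n → Set
  IsFlat X = ∀ B → MaxIndepIn X B → ∀ e → X e ≡ false → M (B ∪ ⁅ e ⁆)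

  contract : Sub n → IndSys n
  contract C I = Disjoint I C × Σ (Sub n) (λ B → MaxIndepIn C B × M (I ∪ B))

  Loop : Fin n → Set
  Loop e = ¬ M ⁅ e ⁆

  Parallel : Fin n → Fin n → Set
  Parallel e f = e ≢ f × M ⁅ e ⁆ × M ⁅ f ⁆ × ¬ M (pair e f)

  IsoToRestriction : ∀ {m} → IndSys m → (Fin m → Fin n) → Set
  IsoToRestriction N f =
    (∀ i j → f i ≡ f j → i ≡ j) × (∀ I → N I ⇔ M (image f I))

  IsoToSimplificationOn : ∀ {m} → Sub n → IndSys m → (Fin m → Fin n) → Set
  IsoToSimplificationOn S N f =
    IsoToRestriction N f ×
    (∀ i → S (f i) ≡ true) ×
    (∀ i → ¬ Loop (f i)) ×
    (∀ i j → ¬ Parallel (f i) (f j)) ×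
    (∀ e → S e ≡ true → ¬ Loop e → Σ (Fin _) (λ i → f i ≡ e ⊎ Parallel e (f i)))

module _ (𝔽 : FiniteField) where
  open FiniteField 𝔽

  sumF : ∀ {n} → (Fin n → Carrier) → Carrier
  sumF {zero}  c = 0#
  sumF {suc n} c = c zero + sumF (λ i → c (suc i))

  record Config : Set where
    constructor config
    field
      rk  : ℕ
      el  : ℕ
      vec : Fin el → Fin rk → Carrier
  open Config public

  Ind : (c : Config) → IndSys (el c)
  Ind c I = ∀ (a : Fin (el c) → Carrier) →
    (∀ i → I i ≡ false → a i ≡ 0#) →
    (∀ k → sumF (λ i → a i * vec c i k) ≡ 0#) →
    ∀ i → a i ≡ 0#

  Simple : Config → Set
  Simple c = (∀ i → Ind c ⁅ i ⁆) × (∀ i j → i ≢ j → Ind c (pair i j))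

  Iso : Config → Config → Set
  Iso c d = Σ (Fin (el c) ↔ Fin (el d)) λ σ →
    ∀ I → Ind c I ⇔ Ind d (λ j → I (Inverse.from σ j))

  IsRestrictionToFlat : Config → Config → Set
  IsRestrictionToFlat c d = Σ (Sub (el c)) λ X → Σ (Fin (el d) → Fin (el c)) λ f →
    IsFlat (Ind c) X × IsoToRestriction (Ind c) (Ind d) f ×
    (∀ j → X j ≡ true → Σ (Fin (el d)) λ i → f i ≡ j) ×
    (∀ i → X (f i) ≡ true)

  IsSimpleContraction : Config → Config → Set
  IsSimpleContraction c d = Σ (Sub (el c)) λ C → Σ (Fin (el d) → Fin (el c)) λ f →
    IsoToSimplificationOn (contract (Ind c) C) (λ j → not (C j)) (Ind d) f

  InducedMinorClosed : (Config → Set) → Set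
  InducedMinorClosed 𝓜 =
    (∀ c d → 𝓜 c → IsRestrictionToFlat c d → 𝓜 d) ×
    (∀ c d → 𝓜 c → IsSimpleContraction c d → 𝓜 d)

  ContractionClosed : (Config → Set) → Set
  ContractionClosed 𝓜 = ∀ c d → 𝓜 c → IsSimpleContraction c d → 𝓜 d

  -- q-coning: c ⊆ F^r, tip p = e_{r+1}; the points are p and (x, a) for each
  -- point x of c and each a ∈ F (the line through p and x minus p).
  unitLast : ∀ r → Fin (suc r) → Carrier
  unitLast zero    zero    = 1#
  unitLast (suc r) zero    = 0#
  unitLast (suc r) (suc k) = unitLast r k

  extend : ∀ {r} → (Fin r → Carrier) → Carrier → Fin (suc r) → Carrier
  extend {zero}  x a zero    = a
  extend {suc r} x a zero    = x zero
  extend {suc r} x a (suc k) = extend (λ k' → x (suc k')) a k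

  coning : Config → Config
  coning (config r n v) = config (suc r) (suc (n ℕ.* size)) w
    where
    w : Fin (suc (n ℕ.* size)) → Fin (suc r) → Carrier
    w zero    = unitLast r
    w (suc k) with remQuot size k
    ... | i , a = extend (v i) (Inverse.to enum a)

  -- the class  M̂ : members of M and everything obtained from them by
  -- repeated q-conings (classes are taken up to matroid isomorphism)
  data Hat (𝓜 : Config → Set) : Config → Set where
    base : ∀ {c} → 𝓜 c → Hat 𝓜 c
    cone : ∀ {c} → Hat 𝓜 c → Hat 𝓜 (coning c)
    iso  : ∀ {c d} → Hat 𝓜 c → Iso c d → Hat 𝓜 d

{-# OPTIONS --safe #-}
module Submission where

open import Defs
open import Level using (Level; 0ℓ)
open import Algebra.Bundles using (CommutativeRing)
open import Data.Nat.Base as ℕ using (ℕ; zero; suc)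
open import Data.Fin using (Fin; zero; suc; remQuot; combine; quotient; inject₁; fromℕ) renaming (_≟_ to _≟ᶠ_)
open import Data.Fin.Properties using (any?; all?; ¬∀⟶∃¬; suc-injective; remQuot-combine; combine-remQuot)
open import Data.Vec.Functional using (Vector; replicate; zipWith; map; _∷_; tail; init; last)
open import Data.Bool.Base using (Bool; true; false; _∧_; _∨_; not; if_then_else_)
open import Data.Bool.Properties using (T-≡; T-∧) renaming (_≟_ to _≟ᵇ_)
open import Data.Integer.Base using (0ℤ; 1ℤ)
open import Data.List.Base using (allFin)
import Data.List.Relation.Unary.Any as Any
open import Data.List.Relation.Unary.Any.Properties using (any⁺; any⁻)
open import Data.List.Membership.Propositional using (find)
open import Data.List.Membership.Propositional.Properties using (∈-allFin)
open import Data.Product.Base using (Σ; _×_; _,_; proj₁; proj₂; map₂)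
open import Data.Sum.Base as Sum using (_⊎_; inj₁; inj₂; [_,_]′)
open import Data.Empty using (⊥-elim)
open import Function.Base using (_∘_; id; case_of_)
open import Function.Bundles using (Inverse; Injection; _↔_; mk↔ₛ′; _⇔_; mk⇔; Equivalence)
open import Function.Properties.Inverse using (↔⇒↣)
open import Function.Construct.Composition using (_⇔-∘_)
open import Function.Construct.Symmetry using (↔-sym; ⇔-sym)
open import Relation.Nullary using (¬_; Dec; yes; no; ¬?)
open import Relation.Nullary.Decidable using (map′; _×-dec_)
open import Relation.Binary.Definitions using (DecidableEquality)
open import Relation.Binary.PropositionalEquality
  using (_≡_; _≢_; refl; sym; trans; cong; cong₂; subst; subst₂; _≗_; module ≡-Reasoning)

-- Let A(N) be the cone with tip p over a configuration N, and contract a set C of its points.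
-- Write C₀ for the points x of N such that some point (x, a) of the line px lies in C, and
-- project N along span C₀, so that N / C₀ is represented by vectors u₀.
-- If p ∈ span C, projecting A(N) along span C kills p and sends every (x, a) to u₀(x), so
-- si(A(N) / C) ≅ si(N / C₀). Otherwise some functional ψ vanishes on C with ψ(p) = 1; adding
-- it as a last coordinate sends p to a new unit vector and (x, a) to (u₀(x), ψ(x, 0) + a),
-- and since a ranges over all of GF(q) this is again a cone: si(A(N) / C) ≅ A(si(N / C₀)).
-- Induction on the derivation of membership in M̂ then reduces everything to contractions
-- of members of M.

-- Coefficients are normalised by evaluation, so they cannot live in an abstract ring; they
-- are integers, interpreted through the canonical morphism ℤ → R.
module ℤ-RingSolver {c ℓ : Level} (R : CommutativeRing c ℓ) where
  open import Data.Nat.Base using (z≤n; s≤s)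
  import Data.Nat.Properties as ℕ
  open import Data.Integer.Base as ℤ using (ℤ; +_; -[1+_]; _⊖_; sign; ∣_∣; _◃_)
  import Data.Integer.Properties as ℤ
  open import Data.Sign.Base as Sign using (Sign)
  open import Data.Maybe.Base using (Maybe; just; nothing)
  open CommutativeRing R renaming (refl to ≈-refl; sym to ≈-sym; trans to ≈-trans)
  open import Relation.Binary.Reasoning.Setoid setoid
  -- With this multiple, ⟦ 1ℤ ⟧ is 1# by definition, so constants of solved equations match 1#.
  open import Algebra.Properties.Monoid.Mult.TCOptimised +-monoid using (×-homo-+; 1+×) renaming (_×_ to _×′_)
  open import Algebra.Properties.Semiring.Mult.TCOptimised semiring using (×1-homo-*)
  open import Algebra.Properties.Ring ring using (-0#≈0#; -‿involutive; -‿+-comm; -1*x≈-x)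
  open import Algebra.Properties.CommutativeSemigroup +-commutativeSemigroup
    using () renaming (interchange to +-interchange)
  open import Algebra.Properties.CommutativeSemigroup *-commutativeSemigroup
    using () renaming (interchange to *-interchange)
  open import Algebra.Solver.Ring.AlmostCommutativeRing
    using (_-Raw-AlmostCommutative⟶_; fromCommutativeRing)

  ⟦_⟧ : ℤ → Carrier
  ⟦ + n ⟧      = n ×′ 1#
  ⟦ -[1+ n ] ⟧ = - (suc n ×′ 1#)

  ⟦_⟧ˢ : Sign → Carrier
  ⟦ Sign.+ ⟧ˢ = 1#
  ⟦ Sign.- ⟧ˢ = - 1#

  [a+b]-[a+c]≈b-c : ∀ a b c → (a + b) - (a + c) ≈ b - c
  [a+b]-[a+c]≈b-c a b c = begin
    (a + b) + - (a + c)    ≈⟨ +-congˡ (-‿+-comm a c) ⟨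
    (a + b) + (- a + - c)  ≈⟨ +-interchange a b (- a) (- c) ⟩
    (a - a) + (b - c)      ≈⟨ +-congʳ (-‿inverseʳ a) ⟩
    0# + (b - c)           ≈⟨ +-identityˡ (b - c) ⟩
    b - c                  ∎

  ⊖-homo : ∀ m n → ⟦ m ⊖ n ⟧ ≈ m ×′ 1# - n ×′ 1#
  ⊖-homo m zero rewrite ℤ.⊖-≥ (z≤n {m}) = begin
    m ×′ 1#          ≈⟨ +-identityʳ (m ×′ 1#) ⟨
    m ×′ 1# + 0#     ≈⟨ +-congˡ -0#≈0# ⟨
    m ×′ 1# - 0#     ∎
  ⊖-homo zero (suc n) rewrite ℤ.⊖-< (s≤s (z≤n {n})) = ≈-sym (+-identityˡ _)
  ⊖-homo (suc m) (suc n) rewrite ℤ.[1+m]⊖[1+n]≡m⊖n m n = begin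
    ⟦ m ⊖ n ⟧                          ≈⟨ ⊖-homo m n ⟩
    m ×′ 1# - n ×′ 1#                  ≈⟨ [a+b]-[a+c]≈b-c 1# (m ×′ 1#) (n ×′ 1#) ⟨
    (1# + m ×′ 1#) - (1# + n ×′ 1#)    ≈⟨ +-cong (1+× m 1#) (-‿cong (1+× n 1#)) ⟨
    suc m ×′ 1# - suc n ×′ 1#          ∎

  +-homo : ∀ i j → ⟦ i ℤ.+ j ⟧ ≈ ⟦ i ⟧ + ⟦ j ⟧
  +-homo (+ m)      (+ n)      = ×-homo-+ 1# m n
  +-homo (+ m)      -[1+ n ]   = ⊖-homo m (suc n)
  +-homo -[1+ m ]   (+ n)      = ≈-trans (⊖-homo n (suc m)) (+-comm _ _)
  +-homo -[1+ m ]   -[1+ n ]   = begin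
    - (suc (suc (m ℕ.+ n)) ×′ 1#)       ≡⟨ cong (λ k → - (suc k ×′ 1#)) (ℕ.+-suc m n) ⟨
    - ((suc m ℕ.+ suc n) ×′ 1#)         ≈⟨ -‿cong (×-homo-+ 1# (suc m) (suc n)) ⟩
    - (suc m ×′ 1# + suc n ×′ 1#)       ≈⟨ -‿+-comm _ _ ⟨
    - (suc m ×′ 1#) + - (suc n ×′ 1#)   ∎

  -‿homo : ∀ i → ⟦ ℤ.- i ⟧ ≈ - ⟦ i ⟧
  -‿homo (+ zero)    = ≈-sym -0#≈0#
  -‿homo (+ suc n)   = ≈-refl
  -‿homo -[1+ n ]    = ≈-sym (-‿involutive _)

  ◃-homo : ∀ s n → ⟦ s ◃ n ⟧ ≈ ⟦ s ⟧ˢ * (n ×′ 1#)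
  ◃-homo s       zero    = ≈-sym (zeroʳ ⟦ s ⟧ˢ)
  ◃-homo Sign.+ (suc n) = ≈-sym (*-identityˡ _)
  ◃-homo Sign.- (suc n) = ≈-sym (-1*x≈-x _)

  sign-abs : ∀ i → ⟦ i ⟧ ≈ ⟦ sign i ⟧ˢ * (∣ i ∣ ×′ 1#)
  sign-abs (+ n)    = ≈-sym (*-identityˡ _)
  sign-abs -[1+ n ] = ≈-sym (-1*x≈-x _)

  sign-homo : ∀ s t → ⟦ s Sign.* t ⟧ˢ ≈ ⟦ s ⟧ˢ * ⟦ t ⟧ˢ
  sign-homo Sign.+ t      = ≈-sym (*-identityˡ _)
  sign-homo Sign.- Sign.+ = ≈-sym (*-identityʳ _)
  sign-homo Sign.- Sign.- = begin
    1#               ≈⟨ -‿involutive 1# ⟨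
    - (- 1#)         ≈⟨ -1*x≈-x (- 1#) ⟨
    - 1# * - 1#      ∎

  *-homo : ∀ i j → ⟦ i ℤ.* j ⟧ ≈ ⟦ i ⟧ * ⟦ j ⟧
  *-homo i j = begin
    ⟦ sign i Sign.* sign j ◃ ∣ i ∣ ℕ.* ∣ j ∣ ⟧
      ≈⟨ ◃-homo _ (∣ i ∣ ℕ.* ∣ j ∣) ⟩
    ⟦ sign i Sign.* sign j ⟧ˢ * ((∣ i ∣ ℕ.* ∣ j ∣) ×′ 1#)
      ≈⟨ *-cong (sign-homo (sign i) (sign j)) (×1-homo-* ∣ i ∣ ∣ j ∣) ⟩
    (⟦ sign i ⟧ˢ * ⟦ sign j ⟧ˢ) * ((∣ i ∣ ×′ 1#) * (∣ j ∣ ×′ 1#))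
      ≈⟨ *-interchange _ _ _ _ ⟩
    (⟦ sign i ⟧ˢ * (∣ i ∣ ×′ 1#)) * (⟦ sign j ⟧ˢ * (∣ j ∣ ×′ 1#))
      ≈⟨ *-cong (sign-abs i) (sign-abs j) ⟨
    ⟦ i ⟧ * ⟦ j ⟧ ∎

  ℤ-morphism : ℤ.+-*-rawRing -Raw-AlmostCommutative⟶ fromCommutativeRing R
  ℤ-morphism = record
    { ⟦_⟧    = ⟦_⟧
    ; +-homo = +-homo
    ; *-homo = *-homo
    ; -‿homo = -‿homo
    ; 0-homo = ≈-refl
    ; 1-homo = ≈-refl
    }

  _≟⟦⟧_ : ∀ i j → Maybe (⟦ i ⟧ ≈ ⟦ j ⟧)
  i ≟⟦⟧ j with i ℤ.≟ j
  ... | yes refl = just ≈-refl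
  ... | no _     = nothing

  open import Algebra.Solver.Ring ℤ.+-*-rawRing (fromCommutativeRing R) ℤ-morphism _≟⟦⟧_ public
    using (solve; _:=_; _:+_; _:*_; :-_; _:-_; con)

-- Subsets of Fin n

private variable
  m n : ℕ

by-cases : ∀ {ℓ} {A : Set ℓ} (b : Bool) → (b ≡ true → A) → (b ≡ false → A) → A
by-cases true  t f = t refl
by-cases false t f = f refl

≡true⇒≢false : ∀ {b} → b ≡ true → b ≢ false
≡true⇒≢false refl ()

≡true-ext : ∀ {a b : Bool} → (a ≡ true → b ≡ true) → (b ≡ true → a ≡ true) → a ≡ b
≡true-ext {false} {false} _ _ = refl
≡true-ext {false} {true}  _ g = g refl
≡true-ext {true}  {false} f _ = sym (f refl)
≡true-ext {true}  {true}  _ _ = refl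

∨-≡trueˡ : ∀ {a} b → a ≡ true → a ∨ b ≡ true
∨-≡trueˡ b refl = refl

∨-≡true⁻ : ∀ {a b} → a ∨ b ≡ true → a ≡ true ⊎ b ≡ true
∨-≡true⁻ {true}  _ = inj₁ refl
∨-≡true⁻ {false} e = inj₂ e

∨-≡false⁻ : ∀ {a b} → a ∨ b ≡ false → a ≡ false × b ≡ false
∨-≡false⁻ {false} {false} _ = refl , refl

∈⁅⁆⁺ : {i j : Fin n} → i ≡ j → ⁅ i ⁆ j ≡ true
∈⁅⁆⁺ {i = i} {j} i≡j with i ≟ᶠ j
... | yes _   = refl
... | no i≢j = ⊥-elim (i≢j i≡j)

∈⁅⁆⁻ : {i j : Fin n} → ⁅ i ⁆ j ≡ true → i ≡ j
∈⁅⁆⁻ {i = i} {j} _ with i ≟ᶠ j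
∈⁅⁆⁻ _ | yes i≡j = i≡j

∉⁅⁆⁺ : {i j : Fin n} → i ≢ j → ⁅ i ⁆ j ≡ false
∉⁅⁆⁺ {i = i} {j} i≢j with i ≟ᶠ j
... | yes i≡j = ⊥-elim (i≢j i≡j)
... | no _    = refl

∉⁅⁆⁻ : {i j : Fin n} → ⁅ i ⁆ j ≡ false → i ≢ j
∉⁅⁆⁻ j∉ i≡j = ≡true⇒≢false (∈⁅⁆⁺ i≡j) j∉

_─_ : Sub n → Fin n → Sub n
(X ─ i) j = X j ∧ not (⁅ i ⁆ j)

module _ {X : Sub n} {i j : Fin n} where

  ─-≡true⁺ : X j ≡ true → i ≢ j → (X ─ i) j ≡ true
  ─-≡true⁺ j∈X i≢j rewrite j∈X | ∉⁅⁆⁺ i≢j = refl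

  ─-≡true⁻ : (X ─ i) j ≡ true → X j ≡ true × i ≢ j
  ─-≡true⁻ j∈ with X j | i ≟ᶠ j
  ... | true | no i≢j = refl , i≢j

  ─-≡false⁻ : (X ─ i) j ≡ false → X j ≡ false ⊎ i ≡ j
  ─-≡false⁻ j∉ with X j | i ≟ᶠ j
  ... | false | _       = inj₁ refl
  ... | true  | yes i≡j = inj₂ i≡j

─-self : (X : Sub n) (i : Fin n) → (X ─ i) i ≡ false
─-self X i rewrite ∈⁅⁆⁺ {i = i} refl with X i
... | true  = refl
... | false = refl

─-∪-⁅⁆ : (X : Sub n) {i : Fin n} → X i ≡ true → ∀ j → X j ≡ ((X ─ i) ∪ ⁅ i ⁆) j
─-∪-⁅⁆ X {i} i∈X j with i ≟ᶠ j
... | yes refl rewrite i∈X = refl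
... | no _ with X j
...   | true  = refl
...   | false = refl

module _ (f : Fin m → Fin n) {I : Sub m} where

  image⁺ : ∀ {i j} → I i ≡ true → f i ≡ j → image f I j ≡ true
  image⁺ {i} {j} i∈I fi≡j = Equivalence.to T-≡ (any⁺ _ (Any.map i∈ (∈-allFin i)))
    where
    i∈ : ∀ {k} → i ≡ k → _
    i∈ refl = Equivalence.from T-∧ (Equivalence.from T-≡ i∈I , Equivalence.from T-≡ (∈⁅⁆⁺ fi≡j))

  image⁻ : ∀ {j} → image f I j ≡ true → Σ (Fin m) λ i → I i ≡ true × f i ≡ j
  image⁻ j∈ with find (any⁻ _ (allFin m) (Equivalence.from T-≡ j∈))
  ... | i , _ , i∈ with Equivalence.to T-∧ i∈
  ...   | i∈I , fi≡j = i , Equivalence.to T-≡ i∈I , ∈⁅⁆⁻ (Equivalence.to T-≡ fi≡j)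

-- Transport of matroid notions along bijections

Extensional : ∀ {n} → IndSys n → Set
Extensional M = ∀ {I J} → I ≗ J → M I → M J

contract-cong : ∀ {n} {M : IndSys n} → Extensional M →
  ∀ {C C′ X X′} → C ≗ C′ → X ≗ X′ → contract M C X → contract M C′ X′
contract-cong M-ext C≗C′ X≗X′ (X∩C≡∅ , B , (B⊆C , MB , maxB) , MX∪B) =
  (λ i i∈X′ → trans (sym (C≗C′ i)) (X∩C≡∅ i (trans (X≗X′ i) i∈X′))) , B ,
  ((λ i i∈B → trans (sym (C≗C′ i)) (B⊆C i i∈B)) , MB , (λ e e∈C′ → maxB e (trans (C≗C′ e) e∈C′))) ,
  M-ext (λ i → cong (_∨ B i) (X≗X′ i)) MX∪B

infix 4 _≅⟨_⟩_
_≅⟨_⟩_ : ∀ {n n′} → IndSys n → Fin n ↔ Fin n′ → IndSys n′ → Set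
M ≅⟨ σ ⟩ M′ = ∀ X → M X ⇔ M′ (X ∘ Inverse.from σ)

module _ {A B : Set} (σ : A ↔ B) where

  to-injective : ∀ {a b} → Inverse.to σ a ≡ Inverse.to σ b → a ≡ b
  to-injective = Injection.injective (↔⇒↣ σ)

  from-injective : ∀ {a b} → Inverse.from σ a ≡ Inverse.from σ b → a ≡ b
  from-injective = Injection.injective (↔⇒↣ (↔-sym σ))

module _ {n n′ : ℕ} (σ : Fin n ↔ Fin n′) where
  open Inverse σ using (to; from; strictlyInverseˡ; strictlyInverseʳ)

  ⁅⁆∘from : ∀ e → ⁅ e ⁆ ∘ from ≗ ⁅ to e ⁆
  ⁅⁆∘from e j = ≡true-ext
    (λ p → ∈⁅⁆⁺ (trans (cong to (∈⁅⁆⁻ p)) (strictlyInverseˡ j)))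
    (λ p → ∈⁅⁆⁺ (trans (sym (strictlyInverseʳ e)) (cong from (∈⁅⁆⁻ p))))

  module _ {M : IndSys n} {M′ : IndSys n′} (M≅M′ : M ≅⟨ σ ⟩ M′) (M′-ext : Extensional M′) where

    private
      ⇒ : ∀ {X} → M X → M′ (X ∘ from)
      ⇒ = Equivalence.to (M≅M′ _)
      ⇐ : ∀ {X} → M′ (X ∘ from) → M X
      ⇐ = Equivalence.from (M≅M′ _)

    ≅-extensional : Extensional M
    ≅-extensional I≗J = ⇐ ∘ M′-ext (I≗J ∘ from) ∘ ⇒

    MaxIndepIn-transport : ∀ {C B} → MaxIndepIn M C B → MaxIndepIn M′ (C ∘ from) (B ∘ from)
    MaxIndepIn-transport {C} {B} (B⊆C , MB , maxB) = B⊆C ∘ from , ⇒ MB , max′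
      where
      max′ : ∀ e → C (from e) ≡ true → B (from e) ≡ false → ¬ M′ ((B ∘ from) ∪ ⁅ e ⁆)
      max′ e e∈C e∉B M′B∪e = maxB (from e) e∈C e∉B (⇐ (M′-ext ∪≗ M′B∪e))
        where
        ∪≗ : (B ∘ from) ∪ ⁅ e ⁆ ≗ (B ∪ ⁅ from e ⁆) ∘ from
        ∪≗ j = cong (B (from j) ∨_) (trans (cong (λ x → ⁅ x ⁆ j) (sym (strictlyInverseˡ e))) (sym (⁅⁆∘from (from e) j)))

    contract-transport : ∀ {C X} → contract M C X → contract M′ (C ∘ from) (X ∘ from)
    contract-transport (X∩C≡∅ , B , maxB , MX∪B) = X∩C≡∅ ∘ from , B ∘ from , MaxIndepIn-transport maxB , ⇒ MX∪B


    ≅-sym : M′ ≅⟨ ↔-sym σ ⟩ M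
    ≅-sym Y = mk⇔ (⇐ ∘ M′-ext (λ j → cong Y (sym (strictlyInverseˡ j))))
                  (M′-ext (λ j → cong Y (strictlyInverseˡ j)) ∘ ⇒)

module _ {n n′ : ℕ} (σ : Fin n ↔ Fin n′) {M : IndSys n} {M′ : IndSys n′}
         (M≅M′ : M ≅⟨ σ ⟩ M′) (M′-ext : Extensional M′) where
  open Inverse σ using (to; from; strictlyInverseˡ; strictlyInverseʳ)

  contract-≅ : ∀ C′ → contract M (C′ ∘ to) ≅⟨ σ ⟩ contract M′ C′
  contract-≅ C′ X = mk⇔
    (contract-cong M′-ext (cong C′ ∘ strictlyInverseˡ) (λ _ → refl) ∘ contract-transport σ M≅M′ M′-ext)
    (contract-cong M-ext (λ _ → refl) (cong X ∘ strictlyInverseʳ) ∘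
       contract-transport (↔-sym σ) (≅-sym σ M≅M′ M′-ext) M-ext)
    where M-ext = ≅-extensional σ M≅M′ M′-ext

  private
    ⇒ : ∀ {X} → M X → M′ (X ∘ from)
    ⇒ = Equivalence.to (M≅M′ _)
    ⇐ : ∀ {X} → M′ (X ∘ from) → M X
    ⇐ = Equivalence.from (M≅M′ _)

    ⁅⁆⇔ : ∀ {e} → M ⁅ e ⁆ ⇔ M′ ⁅ to e ⁆
    ⁅⁆⇔ {e} = mk⇔ (M′-ext (⁅⁆∘from σ e) ∘ ⇒) (⇐ ∘ M′-ext (sym ∘ ⁅⁆∘from σ e))

    pair⇔ : ∀ {e e′} → M (pair e e′) ⇔ M′ (pair (to e) (to e′))
    pair⇔ {e} {e′} = mk⇔ (M′-ext pair≗ ∘ ⇒) (⇐ ∘ M′-ext (sym ∘ pair≗))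
      where pair≗ = λ j → cong₂ _∨_ (⁅⁆∘from σ e j) (⁅⁆∘from σ e′ j)

    Parallel⇒ : ∀ {e e′} → Parallel M e e′ → Parallel M′ (to e) (to e′)
    Parallel⇒ (e≢e′ , Me , Me′ , ¬Mee′) =
      e≢e′ ∘ to-injective σ , Equivalence.to ⁅⁆⇔ Me , Equivalence.to ⁅⁆⇔ Me′ , ¬Mee′ ∘ Equivalence.from pair⇔

    Parallel⇐ : ∀ {e e′} → Parallel M′ (to e) (to e′) → Parallel M e e′
    Parallel⇐ (e≢e′ , Me , Me′ , ¬Mee′) =
      e≢e′ ∘ cong to , Equivalence.from ⁅⁆⇔ Me , Equivalence.from ⁅⁆⇔ Me′ , ¬Mee′ ∘ Equivalence.to pair⇔

  simplification-transport : ∀ {m} {N : IndSys m} {S′ : Sub n′} {f′ : Fin m → Fin n′} →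
    IsoToSimplificationOn M′ S′ N f′ → IsoToSimplificationOn M (S′ ∘ to) N (from ∘ f′)
  simplification-transport {m} {N} {S′} {f′} ((inj , N⇔M′) , ⊆S′ , ¬loop , ∦ , covers) =
    (inj′ , N⇔M) , ⊆S , ¬loop′ , ∦′ , covers′
    where
    f = from ∘ f′
    f′≗to∘f : ∀ i → f′ i ≡ to (f i)
    f′≗to∘f i = sym (strictlyInverseˡ (f′ i))
    image≗ : ∀ I → image f I ∘ from ≗ image f′ I
    image≗ I j = ≡true-ext
      (λ j∈ → let i , i∈I , fi≡ = image⁻ f j∈ in image⁺ f′ i∈I (from-injective σ fi≡))
      (λ j∈ → let i , i∈I , f′i≡ = image⁻ f′ j∈ in image⁺ f i∈I (cong from f′i≡))
    inj′ : ∀ i j → f i ≡ f j → i ≡ j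
    inj′ i j = inj i j ∘ from-injective σ
    N⇔M : ∀ I → N I ⇔ M (image f I)
    N⇔M I = mk⇔ (⇐ ∘ M′-ext (sym ∘ image≗ I) ∘ Equivalence.to (N⇔M′ I))
                (Equivalence.from (N⇔M′ I) ∘ M′-ext (image≗ I) ∘ ⇒)
    ⊆S : ∀ i → S′ (to (f i)) ≡ true
    ⊆S i = trans (cong S′ (sym (f′≗to∘f i))) (⊆S′ i)
    ¬loop′ : ∀ i → ¬ Loop M (f i)
    ¬loop′ i loop = ¬loop i λ M′f′i → loop (Equivalence.from ⁅⁆⇔ (subst (λ x → M′ ⁅ x ⁆) (f′≗to∘f i) M′f′i))
    ∦′ : ∀ i j → ¬ Parallel M (f i) (f j)
    ∦′ i j p = ∦ i j (subst₂ (Parallel M′) (sym (f′≗to∘f i)) (sym (f′≗to∘f j)) (Parallel⇒ p))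
    covers′ : ∀ e → S′ (to e) ≡ true → ¬ Loop M e → Σ (Fin m) λ i → f i ≡ e Sum.⊎ Parallel M e (f i)
    covers′ e e∈S ¬loop-e = map₂ (Sum.map cover-≡ cover-∥) (covers (to e) e∈S (λ loop → ¬loop-e (loop ∘ Equivalence.to ⁅⁆⇔)))
      where
      cover-≡ : ∀ {i} → f′ i ≡ to e → f i ≡ e
      cover-≡ p = trans (cong from p) (strictlyInverseʳ e)
      cover-∥ : ∀ {i} → Parallel M′ (to e) (f′ i) → Parallel M e (f i)
      cover-∥ {i} p = Parallel⇐ (subst (Parallel M′ (to e)) (f′≗to∘f i) p)

-- Linear algebra over a finite field

module LinearAlgebra (𝔽 : FiniteField) where
  open FiniteField 𝔽 using (Carrier; 0≢1; inverse; enum)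

  commutativeRing : CommutativeRing 0ℓ 0ℓ
  commutativeRing = record { isCommutativeRing = FiniteField.isCommutativeRing 𝔽 }

  open CommutativeRing commutativeRing public
    using (_+_; _*_; -_; _-_; 0#; 1#; +-identityˡ; +-identityʳ; *-identityˡ; *-identityʳ;
           zeroˡ; zeroʳ; +-assoc; *-assoc; +-comm; *-comm; distribˡ; distribʳ; -‿inverseʳ)
  open import Algebra.Properties.Ring (CommutativeRing.ring commutativeRing) public
    using (-‿involutive; -0#≈0#; -1*x≈-x)
  open ℤ-RingSolver commutativeRing public using (solve; _:=_; _:+_; _:*_; :-_; _:-_; con)
  open ≡-Reasoning

  infix 4 _≟_
  _≟_ : DecidableEquality Carrier
  x ≟ y = map′ (from-injective enum) (cong (Inverse.from enum)) (Inverse.from enum x ≟ᶠ Inverse.from enum y)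

  1≢0 : 1# ≢ 0#
  1≢0 = 0≢1 ∘ sym

  inv : (x : Carrier) → x ≢ 0# → Carrier
  inv x x≢0 = proj₁ (inverse x x≢0)

  module _ {x : Carrier} (x≢0 : x ≢ 0#) where

    inv-inverseʳ : x * inv x x≢0 ≡ 1#
    inv-inverseʳ = proj₂ (inverse x x≢0)

    inv-inverseˡ : inv x x≢0 * x ≡ 1#
    inv-inverseˡ = trans (*-comm _ x) inv-inverseʳ

    inv-cancelˡ : ∀ y → inv x x≢0 * (x * y) ≡ y
    inv-cancelˡ y = begin
      inv x x≢0 * (x * y) ≡⟨ *-assoc _ x y ⟨
      inv x x≢0 * x * y   ≡⟨ cong (_* y) inv-inverseˡ ⟩
      1# * y              ≡⟨ *-identityˡ y ⟩
      y                   ∎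

    inv-cancelʳ : ∀ y → x * (inv x x≢0 * y) ≡ y
    inv-cancelʳ y = trans (sym (*-assoc x _ y)) (trans (cong (_* y) inv-inverseʳ) (*-identityˡ y))

    x*y≡0⇒y≡0 : ∀ {y} → x * y ≡ 0# → y ≡ 0#
    x*y≡0⇒y≡0 {y} xy≡0 = trans (sym (inv-cancelˡ y)) (trans (cong (inv x x≢0 *_) xy≡0) (zeroʳ _))

    x*y+z≡0⇒y≡-x⁻¹*z : ∀ y z → x * y + z ≡ 0# → y ≡ - inv x x≢0 * z
    x*y+z≡0⇒y≡-x⁻¹*z y z eq = begin
      y                             ≡⟨ inv-cancelˡ y ⟨
      i * (x * y)                   ≡⟨ solve 4 (λ i x y z → i :* (x :* y) := i :* (x :* y :+ z) :+ (:- i) :* z) refl i x y z ⟩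
      i * (x * y + z) + - i * z     ≡⟨ cong (λ w → i * w + - i * z) eq ⟩
      i * 0# + - i * z              ≡⟨ solve 2 (λ i z → i :* con 0ℤ :+ (:- i) :* z := (:- i) :* z) refl i z ⟩
      - i * z                       ∎
      where i = inv x x≢0

    x≡c*x⇒c≡1 : ∀ {c} → x ≡ c * x → c ≡ 1#
    x≡c*x⇒c≡1 {c} x≡cx = begin
      c                         ≡⟨ solve 1 (λ c → c := (c :- con 1ℤ) :+ con 1ℤ) refl c ⟩
      (c - 1#) + 1#             ≡⟨ cong (_+ 1#) (x*y≡0⇒y≡0 x[c-1]≡0) ⟩
      0# + 1#                   ≡⟨ +-identityˡ 1# ⟩
      1#                        ∎
      where
      x[c-1]≡0 : x * (c - 1#) ≡ 0#
      x[c-1]≡0 = begin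
        x * (c - 1#) ≡⟨ solve 2 (λ x c → x :* (c :- con 1ℤ) := c :* x :- x) refl x c ⟩
        c * x - x    ≡⟨ cong (_- x) x≡cx ⟨
        x - x        ≡⟨ -‿inverseʳ x ⟩
        0#           ∎

  -1≢0 : - 1# ≢ 0#
  -1≢0 -1≡0 = 1≢0 (trans (sym (-‿involutive 1#)) (trans (cong -_ -1≡0) -0#≈0#))

  x-y≡0⇒x≡y : ∀ x y → x - y ≡ 0# → x ≡ y
  x-y≡0⇒x≡y x y x-y≡0 = begin
    x              ≡⟨ solve 2 (λ x y → x := (x :- y) :+ y) refl x y ⟩
    (x - y) + y    ≡⟨ cong (_+ y) x-y≡0 ⟩
    0# + y         ≡⟨ +-identityˡ y ⟩
    y              ∎

  V : ℕ → Set
  V = Vector Carrier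

  0ᵥ : ∀ {K} → V K
  0ᵥ = replicate _ 0#

  infixl 6 _+ᵥ_
  _+ᵥ_ : ∀ {K} → V K → V K → V K
  _+ᵥ_ = zipWith _+_

  infixr 7 _·_
  _·_ : ∀ {K} → Carrier → V K → V K
  c · u = map (c *_) u

  -- Independence in the definitions is phrased with sumF; the library's lemmas about sum are
  -- transferred along ∑≡sum.
  ∑ : ∀ {n} → Vector Carrier n → Carrier
  ∑ = sumF 𝔽

  open import Algebra.Properties.Monoid.Sum (CommutativeRing.+-monoid commutativeRing)
    using (sum; sum-replicate-zero)
  open import Algebra.Properties.CommutativeMonoid.Sum (CommutativeRing.+-commutativeMonoid commutativeRing)
    using (∑-distrib-+) renaming (∑-comm to sum-comm)
  open import Algebra.Properties.Semiring.Sum (CommutativeRing.semiring commutativeRing)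
    using (*-distribˡ-sum)

  ∑≡sum : ∀ {n} (f : Vector Carrier n) → ∑ f ≡ sum f
  ∑≡sum {zero}  f = refl
  ∑≡sum {suc n} f = cong (f zero +_) (∑≡sum (f ∘ suc))

  ∑-cong : ∀ {n} {f g : Vector Carrier n} → f ≗ g → ∑ f ≡ ∑ g
  ∑-cong {zero}  f≗g = refl
  ∑-cong {suc n} f≗g = cong₂ _+_ (f≗g zero) (∑-cong (f≗g ∘ suc))

  module _ {n : ℕ} where

    ∑-zero : {f : Vector Carrier n} → f ≗ (λ _ → 0#) → ∑ f ≡ 0#
    ∑-zero f≗0 = trans (trans (∑-cong f≗0) (∑≡sum {n} (λ _ → 0#))) (sum-replicate-zero n)

    ∑-+ : (f g : Vector Carrier n) → ∑ (λ i → f i + g i) ≡ ∑ f + ∑ g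
    ∑-+ f g = trans (∑≡sum (λ i → f i + g i)) (trans (∑-distrib-+ f g) (sym (cong₂ _+_ (∑≡sum f) (∑≡sum g))))

    ∑-*ˡ : (c : Carrier) (f : Vector Carrier n) → ∑ (λ i → c * f i) ≡ c * ∑ f
    ∑-*ˡ c f = trans (∑≡sum (λ i → c * f i)) (trans (sym (*-distribˡ-sum c f)) (cong (c *_) (sym (∑≡sum f))))

  ∑-comm : ∀ {m n} (f : Fin m → Fin n → Carrier) → ∑ (λ i → ∑ (f i)) ≡ ∑ (λ j → ∑ (λ i → f i j))
  ∑-comm f = begin
    ∑ (λ i → ∑ (f i))            ≡⟨ trans (∑-cong (∑≡sum ∘ f)) (∑≡sum (λ i → sum (f i))) ⟩
    sum (λ i → sum (f i))        ≡⟨ sum-comm f ⟩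
    sum (λ j → sum (λ i → f i j)) ≡⟨ sym (trans (∑-cong (λ j → ∑≡sum (λ i → f i j))) (∑≡sum (λ j → sum (λ i → f i j)))) ⟩
    ∑ (λ j → ∑ (λ i → f i j))    ∎

  δ : ∀ {n} → Fin n → Fin n → Carrier
  δ zero    zero    = 1#
  δ zero    (suc _) = 0#
  δ (suc _) zero    = 0#
  δ (suc i) (suc j) = δ i j

  δ-diag : ∀ {n} (i : Fin n) → δ i i ≡ 1#
  δ-diag zero    = refl
  δ-diag (suc i) = δ-diag i

  δ-offdiag : ∀ {n} {i j : Fin n} → i ≢ j → δ i j ≡ 0#
  δ-offdiag {i = zero}  {zero}  i≢j = ⊥-elim (i≢j refl)
  δ-offdiag {i = zero}  {suc j} _   = refl
  δ-offdiag {i = suc i} {zero}  _   = refl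
  δ-offdiag {i = suc i} {suc j} i≢j = δ-offdiag (i≢j ∘ cong suc)

  ∑-δ : ∀ {n} (j : Fin n) (f : Vector Carrier n) → ∑ (λ i → δ j i * f i) ≡ f j
  ∑-δ zero f = begin
    1# * f zero + ∑ (λ i → 0# * f (suc i)) ≡⟨ cong (1# * f zero +_) (∑-zero (zeroˡ ∘ f ∘ suc)) ⟩
    1# * f zero + 0#                        ≡⟨ solve 1 (λ x → con 1ℤ :* x :+ con 0ℤ := x) refl (f zero) ⟩
    f zero                                  ∎
  ∑-δ (suc j) f = begin
    0# * f zero + ∑ (λ i → δ j i * f (suc i)) ≡⟨ cong (0# * f zero +_) (∑-δ j (f ∘ suc)) ⟩
    0# * f zero + f (suc j)                    ≡⟨ solve 2 (λ x y → con 0ℤ :* x :+ y := y) refl (f zero) (f (suc j)) ⟩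
    f (suc j)                                  ∎

  infix 7 _∙_
  _∙_ : ∀ {K} → V K → V K → Carrier
  φ ∙ y = ∑ (λ k → φ k * y k)

  lincomb : ∀ {n K} → (Fin n → Carrier) → (Fin n → V K) → V K
  lincomb a v k = ∑ (λ i → a i * v i k)

  module _ {K : ℕ} (φ : V K) where

    ∙-congʳ : {y z : V K} → y ≗ z → φ ∙ y ≡ φ ∙ z
    ∙-congʳ y≗z = ∑-cong (λ k → cong (φ k *_) (y≗z k))

    ∙-zeroʳ : φ ∙ 0ᵥ ≡ 0#
    ∙-zeroʳ = ∑-zero (λ k → zeroʳ (φ k))

    ∙-distribʳ : (y z : V K) → φ ∙ (y +ᵥ z) ≡ φ ∙ y + φ ∙ z
    ∙-distribʳ y z = trans (∑-cong (λ k → distribˡ (φ k) (y k) (z k))) (∑-+ (λ k → φ k * y k) (λ k → φ k * z k))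

    ∙-·ʳ : (c : Carrier) (y : V K) → φ ∙ (c · y) ≡ c * (φ ∙ y)
    ∙-·ʳ c y = trans (∑-cong (λ k → solve 3 (λ p c y → p :* (c :* y) := c :* (p :* y)) refl (φ k) c (y k))) (∑-*ˡ c (λ k → φ k * y k))

    ∙-·ˡ : (c : Carrier) (y : V K) → (c · φ) ∙ y ≡ c * (φ ∙ y)
    ∙-·ˡ c y = trans (∑-cong (λ k → *-assoc c (φ k) (y k))) (∑-*ˡ c (λ k → φ k * y k))

    ∙-lincomb : ∀ {n} (a : Fin n → Carrier) (v : Fin n → V K) → φ ∙ lincomb a v ≡ ∑ (λ i → a i * (φ ∙ v i))
    ∙-lincomb a v = begin
      ∑ (λ k → φ k * ∑ (λ i → a i * v i k))     ≡⟨ ∑-cong (λ k → sym (∑-*ˡ (φ k) (λ i → a i * v i k))) ⟩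
      ∑ (λ k → ∑ (λ i → φ k * (a i * v i k)))   ≡⟨ ∑-comm (λ k i → φ k * (a i * v i k)) ⟩
      ∑ (λ i → ∑ (λ k → φ k * (a i * v i k)))
        ≡⟨ ∑-cong (λ i → trans (∑-cong (λ k → reorder (φ k) (a i) (v i k))) (∑-*ˡ (a i) (λ k → φ k * v i k))) ⟩
      ∑ (λ i → a i * (φ ∙ v i))                 ∎
      where reorder = solve 3 (λ p a v → p :* (a :* v) := a :* (p :* v)) refl

  module _ {n K : ℕ} (v : Fin n → V K) where

    lincomb-cong : {a b : Fin n → Carrier} → a ≗ b → lincomb a v ≗ lincomb b v
    lincomb-cong a≗b k = ∑-cong (λ i → cong (_* v i k) (a≗b i))

    lincomb-zero : {a : Fin n → Carrier} → a ≗ (λ _ → 0#) → lincomb a v ≗ 0ᵥ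
    lincomb-zero a≗0 k = ∑-zero (λ i → trans (cong (_* v i k) (a≗0 i)) (zeroˡ (v i k)))

    lincomb-+ : (a b : Fin n → Carrier) → lincomb (λ i → a i + b i) v ≗ lincomb a v +ᵥ lincomb b v
    lincomb-+ a b k = trans (∑-cong (λ i → distribʳ (v i k) (a i) (b i))) (∑-+ (λ i → a i * v i k) (λ i → b i * v i k))

    lincomb-· : (c : Carrier) (a : Fin n → Carrier) → lincomb (λ i → c * a i) v ≗ c · lincomb a v
    lincomb-· c a k = trans (∑-cong (λ i → *-assoc c (a i) (v i k))) (∑-*ˡ c (λ i → a i * v i k))

    lincomb-δ : (j : Fin n) → lincomb (δ j) v ≗ v j
    lincomb-δ j k = ∑-δ j (λ i → v i k)

  SupportedOn : ∀ {n} → (Fin n → Carrier) → Sub n → Set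
  SupportedOn a X = ∀ i → X i ≡ false → a i ≡ 0#

  data Span {n K} (v : Fin n → V K) (X : Sub n) : V K → Set where
    span-0    : ∀ {y} → y ≗ 0ᵥ → Span v X y
    span-step : ∀ {y z} i c → X i ≡ true → Span v X z → y ≗ z +ᵥ c · v i → Span v X y

  module _ {n K : ℕ} {v : Fin n → V K} where

    Span-cong : ∀ {X y y'} → y ≗ y' → Span v X y → Span v X y'
    Span-cong y≗y' (span-0 y≗0)                = span-0 (λ k → trans (sym (y≗y' k)) (y≗0 k))
    Span-cong y≗y' (span-step i c i∈X sp y≗) = span-step i c i∈X sp (λ k → trans (sym (y≗y' k)) (y≗ k))

    Span-∈ : ∀ {X i} → X i ≡ true → Span v X (v i)
    Span-∈ {i = i} i∈X = span-step i 1# i∈X (span-0 (λ _ → refl))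
      (λ k → solve 1 (λ x → x := con 0ℤ :+ con 1ℤ :* x) refl (v i k))

    Span-+ : ∀ {X y z} → Span v X y → Span v X z → Span v X (y +ᵥ z)
    Span-+ {z = z} (span-0 y≗0) sz =
      Span-cong (λ k → trans (sym (+-identityˡ (z k))) (cong (_+ z k) (sym (y≗0 k)))) sz
    Span-+ {z = z} (span-step {z = w} i c i∈X sw y≗) sz = span-step i c i∈X (Span-+ sw sz)
      (λ k → trans (cong (_+ z k) (y≗ k))
        (solve 4 (λ w c v z → (w :+ c :* v) :+ z := (w :+ z) :+ c :* v) refl (w k) c (v i k) (z k)))

    Span-· : ∀ {X y} c → Span v X y → Span v X (c · y)
    Span-· c (span-0 y≗0) = span-0 (λ k → trans (cong (c *_) (y≗0 k)) (zeroʳ c))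
    Span-· c (span-step {z = w} i d i∈X sw y≗) = span-step i (c * d) i∈X (Span-· c sw)
      (λ k → trans (cong (c *_) (y≗ k))
        (solve 4 (λ c w d v → c :* (w :+ d :* v) := c :* w :+ (c :* d) :* v) refl c (w k) d (v i k)))

    annihilator-Span : ∀ {X} (φ : V K) → (∀ i → X i ≡ true → φ ∙ v i ≡ 0#) → ∀ {y} → Span v X y → φ ∙ y ≡ 0#
    annihilator-Span φ φX≡0 (span-0 y≗0) = trans (∙-congʳ φ y≗0) (∙-zeroʳ φ)
    annihilator-Span φ φX≡0 {y} (span-step {z = w} i c i∈X sw y≗) = begin
      φ ∙ y                   ≡⟨ ∙-congʳ φ y≗ ⟩
      φ ∙ (w +ᵥ c · v i)      ≡⟨ ∙-distribʳ φ w (c · v i) ⟩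
      φ ∙ w + φ ∙ (c · v i)   ≡⟨ cong₂ _+_ (annihilator-Span φ φX≡0 sw) (∙-·ʳ φ c (v i)) ⟩
      0# + c * (φ ∙ v i)      ≡⟨ cong (λ x → 0# + c * x) (φX≡0 i i∈X) ⟩
      0# + c * 0#             ≡⟨ solve 1 (λ c → con 0ℤ :+ c :* con 0ℤ := con 0ℤ) refl c ⟩
      0#                      ∎

    Span⇒lincomb : ∀ {X y} → Span v X y → Σ (Fin n → Carrier) λ a → SupportedOn a X × y ≗ lincomb a v
    Span⇒lincomb (span-0 y≗0) = (λ _ → 0#) , (λ _ _ → refl) , (λ k → trans (y≗0 k) (sym (lincomb-zero v (λ _ → refl) k)))
    Span⇒lincomb {X} {y} (span-step {z = w} i c i∈X sw y≗) with Span⇒lincomb sw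
    ... | a , a⊆X , w≗ = (λ j → a j + c * δ i j) , supported , y≗lincomb
      where
      supported : SupportedOn (λ j → a j + c * δ i j) X
      supported j j∉X with i ≟ᶠ j
      ... | yes refl = ⊥-elim (≡true⇒≢false i∈X j∉X)
      ... | no i≢j   = trans (cong₂ (λ p q → p + c * q) (a⊆X j j∉X) (δ-offdiag i≢j))
                              (solve 1 (λ c → con 0ℤ :+ c :* con 0ℤ := con 0ℤ) refl c)
      y≗lincomb : y ≗ lincomb (λ j → a j + c * δ i j) v
      y≗lincomb k = begin
        y k                                   ≡⟨ y≗ k ⟩
        w k + c * v i k                       ≡⟨ cong₂ _+_ (w≗ k) (cong (c *_) (sym (lincomb-δ v i k))) ⟩
        lincomb a v k + c * lincomb (δ i) v k ≡⟨ cong (lincomb a v k +_) (sym (lincomb-· v c (δ i) k)) ⟩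
        lincomb a v k + lincomb (λ j → c * δ i j) v k ≡⟨ sym (lincomb-+ v a _ k) ⟩
        lincomb (λ j → a j + c * δ i j) v k   ∎

  Span-mono : ∀ {n m K} {v : Fin n → V K} {w : Fin m → V K} {X Y} →
    (∀ i → X i ≡ true → Span w Y (v i)) → ∀ {y} → Span v X y → Span w Y y
  Span-mono X⊆ (span-0 y≗0)                = span-0 y≗0
  Span-mono X⊆ (span-step i c i∈X sp y≗) = Span-cong (λ k → sym (y≗ k)) (Span-+ (Span-mono X⊆ sp) (Span-· c (X⊆ i i∈X)))

  Span-⊆ : ∀ {n K} {v : Fin n → V K} {X Y : Sub n} → X ⊆ Y → ∀ {y} → Span v X y → Span v Y y
  Span-⊆ X⊆Y = Span-mono (λ i i∈X → Span-∈ (X⊆Y i i∈X))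

  lincomb⇒Span : ∀ {n K} {v : Fin n → V K} {X : Sub n} (a : Fin n → Carrier) → SupportedOn a X → Span v X (lincomb a v)
  lincomb⇒Span {zero}          a a⊆X = span-0 (λ _ → refl)
  lincomb⇒Span {suc n} {K} {v} {X} a a⊆X = by-cases (X zero) zero∈X zero∉X
    where
    rest : V K
    rest = lincomb (a ∘ suc) (v ∘ suc)
    Span-rest : Span v X rest
    Span-rest = Span-mono (λ i → Span-∈) (lincomb⇒Span {v = v ∘ suc} {X = X ∘ suc} (a ∘ suc) (a⊆X ∘ suc))
    zero∈X : X zero ≡ true → Span v X (lincomb a v)
    zero∈X 0∈X = span-step zero (a zero) 0∈X Span-rest (λ k → +-comm _ _)
    zero∉X : X zero ≡ false → Span v X (lincomb a v)
    zero∉X 0∉X = Span-cong (λ k → sym (begin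
      a zero * v zero k + rest k ≡⟨ cong (λ x → x * v zero k + rest k) (a⊆X zero 0∉X) ⟩
      0# * v zero k + rest k     ≡⟨ solve 2 (λ x y → con 0ℤ :* x :+ y := y) refl (v zero k) (rest k) ⟩
      rest k                     ∎)) Span-rest

  module _ {n K : ℕ} {v : Fin n → V K} where

    Span-∅ : ∀ {X} → (∀ i → X i ≡ false) → ∀ {y} → Span v X y → y ≗ 0ᵥ
    Span-∅ X≡∅ (span-0 y≗0)               = y≗0
    Span-∅ X≡∅ (span-step i _ i∈X _ _) = ⊥-elim (≡true⇒≢false i∈X (X≡∅ i))

    Span-⁅⁆ : ∀ {j y} → Span v ⁅ j ⁆ y → Σ Carrier λ c → y ≗ c · v j
    Span-⁅⁆ (span-0 y≗0) = 0# , (λ k → trans (y≗0 k) (sym (zeroˡ _)))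
    Span-⁅⁆ {j} (span-step i c i∈ sp y≗) with ∈⁅⁆⁻ i∈
    ... | refl with Span-⁅⁆ sp
    ...   | d , z≗ = d + c , (λ k → trans (y≗ k) (trans (cong (_+ c * v j k) (z≗ k)) (sym (distribʳ _ _ _))))

  Independent : ∀ {n K} → (Fin n → V K) → Sub n → Set
  Independent v = Ind 𝔽 (config _ _ v)

  zeroAt : ∀ {n} → Fin n → (Fin n → Carrier) → Fin n → Carrier
  zeroAt j a i = a i - δ j i * a j

  zeroAt-same : ∀ {n} (j : Fin n) a → zeroAt j a j ≡ 0#
  zeroAt-same j a = trans (cong (λ x → a j - x * a j) (δ-diag j))
    (solve 1 (λ x → x :- con 1ℤ :* x := con 0ℤ) refl (a j))

  zeroAt-other : ∀ {n} {j i : Fin n} a → j ≢ i → zeroAt j a i ≡ a i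
  zeroAt-other {j = j} {i} a j≢i = trans (cong (λ x → a i - x * a j) (δ-offdiag j≢i))
    (solve 2 (λ x y → x :- con 0ℤ :* y := x) refl (a i) (a j))

  module _ {n K : ℕ} {v : Fin n → V K} where

    lincomb-zeroAt : ∀ j a k → lincomb a v k ≡ a j * v j k + lincomb (zeroAt j a) v k
    lincomb-zeroAt j a k = begin
      lincomb a v k
        ≡⟨ ∑-cong (λ i → solve 4 (λ x d y w → x :* w := (d :* w) :* y :+ (x :- d :* y) :* w) refl (a i) (δ j i) (a j) (v i k)) ⟩
      ∑ (λ i → (δ j i * v i k) * a j + zeroAt j a i * v i k)
        ≡⟨ ∑-+ (λ i → (δ j i * v i k) * a j) (λ i → zeroAt j a i * v i k) ⟩
      ∑ (λ i → (δ j i * v i k) * a j) + lincomb (zeroAt j a) v k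
        ≡⟨ cong (_+ lincomb (zeroAt j a) v k) (trans (∑-cong (λ i → *-comm (δ j i * v i k) (a j))) (∑-*ˡ (a j) (λ i → δ j i * v i k))) ⟩
      a j * lincomb (δ j) v k + lincomb (zeroAt j a) v k
        ≡⟨ cong (λ x → a j * x + lincomb (zeroAt j a) v k) (lincomb-δ v j k) ⟩
      a j * v j k + lincomb (zeroAt j a) v k ∎

    Independent-cong : ∀ {X Y : Sub n} → X ≗ Y → Independent v X → Independent v Y
    Independent-cong X≗Y ind a a⊆Y = ind a (λ i i∉X → a⊆Y i (trans (sym (X≗Y i)) i∉X))

    dependency⇒Span : ∀ {X} a e → SupportedOn a X → lincomb a v ≗ 0ᵥ → a e ≢ 0# → Span v (X ─ e) (v e)
    dependency⇒Span {X} a e a⊆X Σav≡0 ae≢0 =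
      Span-cong v≗ (Span-· (- inv (a e) ae≢0) (lincomb⇒Span (zeroAt e a) supported))
      where
      supported : SupportedOn (zeroAt e a) (X ─ e)
      supported j j∉ with ─-≡false⁻ {X = X} j∉ | e ≟ᶠ j
      ... | _        | yes refl = zeroAt-same e a
      ... | inj₁ j∉X | no e≢j   = trans (zeroAt-other a e≢j) (a⊆X j j∉X)
      ... | inj₂ e≡j | no e≢j   = ⊥-elim (e≢j e≡j)
      v≗ : (- inv (a e) ae≢0) · lincomb (zeroAt e a) v ≗ v e
      v≗ k = sym (x*y+z≡0⇒y≡-x⁻¹*z ae≢0 (v e k) (lincomb (zeroAt e a) v k)
                   (trans (sym (lincomb-zeroAt e a k)) (Σav≡0 k)))

    Independent-∪⁅⁆ : ∀ {B e} → Independent v B → ¬ Span v B (v e) → Independent v (B ∪ ⁅ e ⁆)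
    Independent-∪⁅⁆ {B} {e} indB e∉spanB a a⊆B∪e Σav≡0 with a e ≟ 0#
    ... | yes ae≡0 = indB a a⊆B Σav≡0
      where
      a⊆B : SupportedOn a B
      a⊆B j j∉B with e ≟ᶠ j
      ... | yes refl = ae≡0
      ... | no e≢j   = a⊆B∪e j (cong₂ _∨_ j∉B (∉⁅⁆⁺ e≢j))
    ... | no ae≢0 = ⊥-elim (e∉spanB (Span-⊆ B∪e─e⊆B (dependency⇒Span a e a⊆B∪e Σav≡0 ae≢0)))
      where
      B∪e─e⊆B : ((B ∪ ⁅ e ⁆) ─ e) ⊆ B
      B∪e─e⊆B j j∈ with ─-≡true⁻ {X = B ∪ ⁅ e ⁆} j∈
      ... | j∈B∪e , e≢j with ∨-≡true⁻ j∈B∪e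
      ...   | inj₁ j∈B = j∈B
      ...   | inj₂ j∈e = ⊥-elim (e≢j (∈⁅⁆⁻ j∈e))

    Span⇒¬Independent-∪⁅⁆ : ∀ {B e} → B e ≡ false → Span v B (v e) → ¬ Independent v (B ∪ ⁅ e ⁆)
    Span⇒¬Independent-∪⁅⁆ {B} {e} e∉B e∈spanB ind with Span⇒lincomb e∈spanB
    ... | b , b⊆B , ve≗ = -1≢0 (trans (sym ae≡-1) (ind a a⊆B∪e Σav≡0 e))
      where
      a : Fin n → Carrier
      a j = b j - δ e j
      a⊆B∪e : SupportedOn a (B ∪ ⁅ e ⁆)
      a⊆B∪e j j∉ with ∨-≡false⁻ {B j} j∉
      ... | j∉B , j∉e = trans (cong₂ _-_ (b⊆B j j∉B) (δ-offdiag (∉⁅⁆⁻ j∉e)))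
                             (solve 0 (con 0ℤ :- con 0ℤ := con 0ℤ) refl)
      Σav≡0 : ∀ k → lincomb a v k ≡ 0#
      Σav≡0 k = begin
        lincomb a v k
          ≡⟨ lincomb-cong v (λ j → solve 2 (λ b d → b :- d := b :+ (:- con 1ℤ) :* d) refl (b j) (δ e j)) k ⟩
        lincomb (λ j → b j + - 1# * δ e j) v k         ≡⟨ lincomb-+ v b _ k ⟩
        lincomb b v k + lincomb (λ j → - 1# * δ e j) v k ≡⟨ cong (lincomb b v k +_) (lincomb-· v (- 1#) (δ e) k) ⟩
        lincomb b v k + - 1# * lincomb (δ e) v k        ≡⟨ cong₂ (λ x y → x + - 1# * y) (sym (ve≗ k)) (lincomb-δ v e k) ⟩
        v e k + - 1# * v e k                            ≡⟨ solve 1 (λ x → x :+ (:- con 1ℤ) :* x := con 0ℤ) refl (v e k) ⟩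
        0#                                              ∎
      ae≡-1 : a e ≡ - 1#
      ae≡-1 = trans (cong₂ _-_ (b⊆B e e∉B) (δ-diag e)) (+-identityˡ _)

    Independent⇒∉Span : ∀ {X} → Independent v X → ∀ i → X i ≡ true → ¬ Span v (X ─ i) (v i)
    Independent⇒∉Span {X} ind i i∈X i∈span =
      Span⇒¬Independent-∪⁅⁆ (─-self X i) i∈span (Independent-cong (─-∪-⁅⁆ X i∈X) ind)

    ∉Span⇒Independent : ∀ {X} → (∀ i → X i ≡ true → ¬ Span v (X ─ i) (v i)) → Independent v X
    ∉Span⇒Independent {X} ∉span a a⊆X Σav≡0 i with a i ≟ 0#
    ... | yes ai≡0 = ai≡0
    ... | no ai≢0  = by-cases (X i)
      (λ i∈X → ⊥-elim (∉span i i∈X (dependency⇒Span a i a⊆X Σav≡0 ai≢0)))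
      (λ i∉X → ⊥-elim (ai≢0 (a⊆X i i∉X)))

  ∙-zeroˡ : ∀ {K} (y : V K) → 0ᵥ ∙ y ≡ 0#
  ∙-zeroˡ y = ∑-zero (λ k → zeroˡ (y k))

  Span-∷ : ∀ {k n} {w : Fin k → V (suc n)} {X : Sub k} → (∀ i → X i ≡ true → w i zero ≡ 0#) →
    ∀ {z} → Span (tail ∘ w) X z → Span w X (0# ∷ z)
  Span-∷ w₀≡0 (span-0 z≗0) = span-0 λ { zero → refl ; (suc k) → z≗0 k }
  Span-∷ w₀≡0 (span-step i c i∈X sp z≗) = span-step i c i∈X (Span-∷ w₀≡0 sp) λ
    { zero    → sym (trans (cong (λ x → 0# + c * x) (w₀≡0 i i∈X)) (solve 1 (λ c → con 0ℤ :+ c :* con 0ℤ := con 0ℤ) refl c))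
    ; (suc k) → z≗ k }

  record Annihilator {k n} (w : Fin k → V n) (X : Sub k) : Set where
    field
      rows     : ℕ
      row      : Fin rows → V n
      kills    : ∀ t i → X i ≡ true → row t ∙ w i ≡ 0#
      complete : ∀ y → (∀ t → row t ∙ y ≡ 0#) → Span w X y

  module _ {k n} {w : Fin k → V (suc n)} {X : Sub k} where

    annihilator-without-pivot : (∀ i → X i ≡ true → w i zero ≡ 0#) → Annihilator (tail ∘ w) X → Annihilator w X
    annihilator-without-pivot w₀≡0 A = record { rows = suc rows ; row = row′ ; kills = kills′ ; complete = complete′ }
      where
      open Annihilator A
      row′ : Fin (suc rows) → V (suc n)
      row′ zero    = 1# ∷ 0ᵥ
      row′ (suc t) = 0# ∷ row t
      kills′ : ∀ t i → X i ≡ true → row′ t ∙ w i ≡ 0#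
      kills′ zero i i∈X = trans (cong₂ (λ x y → 1# * x + y) (w₀≡0 i i∈X) (∙-zeroˡ (tail (w i))))
        (solve 0 (con 1ℤ :* con 0ℤ :+ con 0ℤ := con 0ℤ) refl)
      kills′ (suc t) i i∈X = trans (cong (0# * w i zero +_) (kills t i i∈X))
        (solve 1 (λ x → con 0ℤ :* x :+ con 0ℤ := con 0ℤ) refl (w i zero))
      complete′ : ∀ y → (∀ t → row′ t ∙ y ≡ 0#) → Span w X y
      complete′ y y⊥ = Span-cong (λ { zero → sym y₀≡0 ; (suc _) → refl }) (Span-∷ w₀≡0 (complete (tail y) tail⊥))
        where
        y₀≡0 : y zero ≡ 0#
        y₀≡0 = trans (sym (trans (cong (1# * y zero +_) (∙-zeroˡ (tail y)))
                 (solve 1 (λ x → con 1ℤ :* x :+ con 0ℤ := x) refl (y zero)))) (y⊥ zero)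
        tail⊥ : ∀ t → row t ∙ tail y ≡ 0#
        tail⊥ t = trans (sym (solve 2 (λ x z → con 0ℤ :* x :+ z := z) refl (y zero) (row t ∙ tail y))) (y⊥ (suc t))

    -- Gaussian elimination on the first coordinate with pivot w j.
    module Pivot (j : Fin k) (j∈X : X j ≡ true) (c≢0 : w j zero ≢ 0#) where
      c⁻¹ : Carrier
      c⁻¹ = inv (w j zero) c≢0

      multiplier : Fin k → Carrier
      multiplier i = w i zero * c⁻¹

      reduced : Fin k → V (suc n)
      reduced i = w i +ᵥ (- multiplier i) · w j

      cleared : ∀ a → a + - (a * c⁻¹) * w j zero ≡ 0#
      cleared a = begin
        a + - (a * c⁻¹) * w j zero ≡⟨ solve 3 (λ a i c → a :+ (:- (a :* i)) :* c := a :- a :* (i :* c)) refl a c⁻¹ (w j zero) ⟩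
        a - a * (c⁻¹ * w j zero)   ≡⟨ cong (λ x → a - a * x) (inv-inverseˡ c≢0) ⟩
        a - a * 1#                 ≡⟨ solve 1 (λ a → a :- a :* con 1ℤ := con 0ℤ) refl a ⟩
        0#                         ∎

      reduced₀≡0 : ∀ i → reduced i zero ≡ 0#
      reduced₀≡0 i = cleared (w i zero)

      reduced∈Span : ∀ i → X i ≡ true → Span w X (reduced i)
      reduced∈Span i i∈X = Span-+ (Span-∈ i∈X) (Span-· (- multiplier i) (Span-∈ j∈X))

      annihilator-with-pivot : Annihilator (tail ∘ reduced) X → Annihilator w X
      annihilator-with-pivot A = record { rows = rows ; row = row′ ; kills = kills′ ; complete = complete′ }
        where
        open Annihilator A
        D : Fin rows → Carrier
        D t = row t ∙ tail (w j)
        row′ : Fin rows → V (suc n)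
        row′ t = (- (D t * c⁻¹)) ∷ row t
        tail-split : ∀ i t → row t ∙ tail (w i) ≡ row t ∙ tail (reduced i) + multiplier i * D t
        tail-split i t = begin
          row t ∙ tail (w i)
            ≡⟨ ∙-congʳ (row t) (λ m → solve 3 (λ a s b → a := (a :+ (:- s) :* b) :+ s :* b) refl
                 (w i (suc m)) (multiplier i) (w j (suc m))) ⟩
          row t ∙ (tail (reduced i) +ᵥ multiplier i · tail (w j))
            ≡⟨ trans (∙-distribʳ (row t) _ _) (cong (row t ∙ tail (reduced i) +_) (∙-·ʳ (row t) _ _)) ⟩
          row t ∙ tail (reduced i) + multiplier i * D t ∎
        kills′ : ∀ t i → X i ≡ true → row′ t ∙ w i ≡ 0#
        kills′ t i i∈X = begin
          - (D t * c⁻¹) * w i zero + row t ∙ tail (w i)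
            ≡⟨ cong (- (D t * c⁻¹) * w i zero +_) (trans (tail-split i t) (cong (_+ multiplier i * D t) (kills t i i∈X))) ⟩
          - (D t * c⁻¹) * w i zero + (0# + (w i zero * c⁻¹) * D t)
            ≡⟨ solve 3 (λ d c x → (:- (d :* c)) :* x :+ (con 0ℤ :+ (x :* c) :* d) := con 0ℤ) refl (D t) c⁻¹ (w i zero) ⟩
          0# ∎
        complete′ : ∀ y → (∀ t → row′ t ∙ y ≡ 0#) → Span w X y
        complete′ y y⊥ = Span-cong y′+sw≗y (Span-+ (Span-mono reduced∈Span y′∈Span) (Span-· s (Span-∈ j∈X)))
          where
          s  = y zero * c⁻¹
          y′ : V (suc n)
          y′ = y +ᵥ (- s) · w j
          y′₀≡0 : y′ zero ≡ 0#
          y′₀≡0 = cleared (y zero)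
          tail⊥ : ∀ t → row t ∙ tail y′ ≡ 0#
          tail⊥ t = begin
            row t ∙ tail y′                     ≡⟨ trans (∙-distribʳ (row t) _ _) (cong (row t ∙ tail y +_) (∙-·ʳ (row t) _ _)) ⟩
            row t ∙ tail y + (- s) * D t        ≡⟨ cong (_+ (- s) * D t) (solve 2 (λ p q → q := (p :+ q) :- p) refl (- (D t * c⁻¹) * y zero) _) ⟩
            (row′ t ∙ y - - (D t * c⁻¹) * y zero) + (- s) * D t ≡⟨ cong (λ x → (x - - (D t * c⁻¹) * y zero) + (- s) * D t) (y⊥ t) ⟩
            (0# - - (D t * c⁻¹) * y zero) + - (y zero * c⁻¹) * D t
              ≡⟨ solve 3 (λ d c u → (con 0ℤ :- (:- (d :* c)) :* u) :+ (:- (u :* c)) :* d := con 0ℤ) refl (D t) c⁻¹ (y zero) ⟩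
            0# ∎
          y′∈Span : Span reduced X y′
          y′∈Span = Span-cong (λ { zero → sym y′₀≡0 ; (suc m) → refl }) (Span-∷ (λ i _ → reduced₀≡0 i) (complete (tail y′) tail⊥))
          y′+sw≗y : y′ +ᵥ s · w j ≗ y
          y′+sw≗y m = solve 3 (λ a s b → (a :+ (:- s) :* b) :+ s :* b := a) refl (y m) s (w j m)

  annihilator : ∀ {k} n (w : Fin k → V n) (X : Sub k) → Annihilator w X
  annihilator zero    w X = record { rows = 0 ; row = λ () ; kills = λ () ; complete = λ y _ → span-0 (λ ()) }
  annihilator (suc n) w X with any? (λ i → (X i ≟ᵇ true) ×-dec ¬? (w i zero ≟ 0#))
  ... | yes (j , j∈X , c≢0) = annihilator-with-pivot (annihilator n (tail ∘ reduced) X)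
    where open Pivot {w = w} {X = X} j j∈X c≢0
  ... | no ∄pivot = annihilator-without-pivot w₀≡0 (annihilator n (tail ∘ w) X)
    where
    w₀≡0 : ∀ i → X i ≡ true → w i zero ≡ 0#
    w₀≡0 i i∈X with w i zero ≟ 0#
    ... | yes w₀≡0 = w₀≡0
    ... | no w₀≢0  = ⊥-elim (∄pivot (i , i∈X , w₀≢0))

  Span? : ∀ {k n} (w : Fin k → V n) (X : Sub k) y → Dec (Span w X y)
  Span? w X y = map′ (complete y) (λ y∈ t → annihilator-Span (row t) (kills t) y∈) (all? (λ t → row t ∙ y ≟ 0#))
    where open Annihilator (annihilator _ w X)

  separating-functional : ∀ {k n} (w : Fin k → V n) (X : Sub k) y → ¬ Span w X y →
    Σ (V n) λ φ → (∀ i → X i ≡ true → φ ∙ w i ≡ 0#) × φ ∙ y ≢ 0#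
  separating-functional w X y y∉ =
    let t , φy≢0 = ¬∀⟶∃¬ rows _ (λ t → row t ∙ y ≟ 0#) (y∉ ∘ complete y) in row t , kills t , φy≢0
    where open Annihilator (annihilator _ w X)

  record Basis {n K} (v : Fin n → V K) (C : Sub n) : Set where
    field
      members     : Sub n
      ⊆C          : members ⊆ C
      independent : Independent v members
      spans       : ∀ e → C e ≡ true → Span v members (v e)

    maximal : MaxIndepIn (Independent v) C members
    maximal = ⊆C , independent , λ e e∈C e∉B → Span⇒¬Independent-∪⁅⁆ e∉B (spans e e∈C)

  basis : ∀ {n K} (v : Fin n → V K) (C : Sub n) → Basis v C
  basis {zero}  v C = record { members = λ () ; ⊆C = λ () ; independent = λ _ _ _ () ; spans = λ () }
  basis {suc n} v C with basis (v ∘ suc) (C ∘ suc)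
  ... | record { members = B ; ⊆C = B⊆C ; independent = indB ; spans = spansB } =
    by-cases (C zero) (λ 0∈C → extend-by-zero 0∈C (Span? v B₀ (v zero))) (λ 0∉C → record
      { members = B₀ ; ⊆C = B₀⊆C ; independent = indB₀
      ; spans = λ { zero 0∈C → ⊥-elim (≡true⇒≢false 0∈C 0∉C) ; (suc e) → spans-suc e } })
    where
    B₀ : Sub (suc n)
    B₀ = false ∷ B
    B₀⊆C : B₀ ⊆ C
    B₀⊆C (suc i) = B⊆C i
    indB₀ : Independent v B₀
    indB₀ a a⊆B₀ Σav≡0 zero    = a⊆B₀ zero refl
    indB₀ a a⊆B₀ Σav≡0 (suc i) = indB (a ∘ suc) (a⊆B₀ ∘ suc) tail≡0 i
      where
      tail≡0 : ∀ k → lincomb (a ∘ suc) (v ∘ suc) k ≡ 0#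
      tail≡0 k = trans (sym (begin
        a zero * v zero k + lincomb (a ∘ suc) (v ∘ suc) k ≡⟨ cong (λ x → x * v zero k + lincomb (a ∘ suc) (v ∘ suc) k) (a⊆B₀ zero refl) ⟩
        0# * v zero k + lincomb (a ∘ suc) (v ∘ suc) k     ≡⟨ solve 2 (λ x y → con 0ℤ :* x :+ y := y) refl (v zero k) _ ⟩
        lincomb (a ∘ suc) (v ∘ suc) k                     ∎)) (Σav≡0 k)
    spans-suc : ∀ e → C (suc e) ≡ true → Span v B₀ (v (suc e))
    spans-suc e e∈C = Span-mono (λ i → Span-∈ {X = B₀} {i = suc i}) (spansB e e∈C)
    extend-by-zero : C zero ≡ true → Dec (Span v B₀ (v zero)) → Basis v C
    extend-by-zero 0∈C (yes 0∈span) = record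
      { members = B₀ ; ⊆C = B₀⊆C ; independent = indB₀
      ; spans = λ { zero _ → 0∈span ; (suc e) → spans-suc e } }
    extend-by-zero 0∈C (no 0∉span) = record
      { members = B₀ ∪ ⁅ zero ⁆ ; ⊆C = ⊆C′ ; independent = Independent-∪⁅⁆ indB₀ 0∉span
      ; spans = λ { zero _ → Span-∈ refl ; (suc e) e∈C → Span-⊆ (λ i → ∨-≡trueˡ _) (spans-suc e e∈C) } }
      where
      ⊆C′ : (B₀ ∪ ⁅ zero ⁆) ⊆ C
      ⊆C′ zero    _ = 0∈C
      ⊆C′ (suc i) i∈ with ∨-≡true⁻ {B i} i∈
      ... | inj₁ i∈B = B⊆C i i∈B

  -- Contracting C is projecting along span C: the rows of an annihilator of C form a
  -- linear map with kernel span C, and M[v] / C is represented by the projected vectors.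
  module Projection {n K} {v : Fin n → V K} {C : Sub n} (A : Annihilator v C) where
    open Annihilator A

    projected : Fin n → V rows
    projected i t = row t ∙ v i

    lincomb-projected : ∀ a t → lincomb a projected t ≡ row t ∙ lincomb a v
    lincomb-projected a t = sym (∙-lincomb (row t) a v)

    projected-C : ∀ i → C i ≡ true → projected i ≗ 0ᵥ
    projected-C i i∈C t = kills t i i∈C

    projected-≢0⇒∉C : ∀ i → ¬ projected i ≗ 0ᵥ → not (C i) ≡ true
    projected-≢0⇒∉C i ui≢0 = by-cases (C i) (λ i∈C → ⊥-elim (ui≢0 (projected-C i i∈C))) (cong not)

    contract⇒Independent : ∀ {X} → contract (Independent v) C X → Independent projected X
    contract⇒Independent {X} (X∩C≡∅ , B , (B⊆C , indB , maxB) , indX∪B) a a⊆X Σau≡0 i =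
      by-cases (X i) i∈X⇒ai≡0 (a⊆X i)
      where
      C⊆spanB : ∀ j → C j ≡ true → Span v B (v j)
      C⊆spanB j j∈C with Span? v B (v j)
      ... | yes j∈span = j∈span
      ... | no j∉span  = by-cases (B j) Span-∈ (λ j∉B → ⊥-elim (maxB j j∈C j∉B (Independent-∪⁅⁆ indB j∉span)))
      av∈spanB : Span v B (lincomb a v)
      av∈spanB = Span-mono C⊆spanB (complete (lincomb a v) (λ t → trans (sym (lincomb-projected a t)) (Σau≡0 t)))
      b = proj₁ (Span⇒lincomb av∈spanB)
      b⊆B = proj₁ (proj₂ (Span⇒lincomb av∈spanB))
      av≗bv = proj₂ (proj₂ (Span⇒lincomb av∈spanB))
      a-b⊆X∪B : SupportedOn (λ j → a j - b j) (X ∪ B)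
      a-b⊆X∪B j j∉ with ∨-≡false⁻ {X j} j∉
      ... | j∉X , j∉B = trans (cong₂ _-_ (a⊆X j j∉X) (b⊆B j j∉B)) (solve 0 (con 0ℤ :- con 0ℤ := con 0ℤ) refl)
      Σ[a-b]v≡0 : ∀ k → lincomb (λ j → a j - b j) v k ≡ 0#
      Σ[a-b]v≡0 k = begin
        lincomb (λ j → a j - b j) v k
          ≡⟨ lincomb-cong v (λ j → solve 2 (λ a b → a :- b := a :+ (:- con 1ℤ) :* b) refl (a j) (b j)) k ⟩
        lincomb (λ j → a j + - 1# * b j) v k                ≡⟨ lincomb-+ v a _ k ⟩
        lincomb a v k + lincomb (λ j → - 1# * b j) v k      ≡⟨ cong (lincomb a v k +_) (lincomb-· v (- 1#) b k) ⟩
        lincomb a v k + - 1# * lincomb b v k                ≡⟨ cong (λ x → lincomb a v k + - 1# * x) (sym (av≗bv k)) ⟩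
        lincomb a v k + - 1# * lincomb a v k                ≡⟨ solve 1 (λ x → x :+ (:- con 1ℤ) :* x := con 0ℤ) refl (lincomb a v k) ⟩
        0#                                                  ∎
      i∈X⇒ai≡0 : X i ≡ true → a i ≡ 0#
      i∈X⇒ai≡0 i∈X = trans (x-y≡0⇒x≡y (a i) (b i) (indX∪B _ a-b⊆X∪B Σ[a-b]v≡0 i)) (b⊆B i i∉B)
        where
        i∉B : B i ≡ false
        i∉B = by-cases (B i) (λ i∈B → ⊥-elim (≡true⇒≢false (B⊆C i i∈B) (X∩C≡∅ i i∈X))) (λ i∉B → i∉B)

    Independent⇒contract : ∀ {X} → Independent projected X → contract (Independent v) C X
    Independent⇒contract {X} indX = X∩C≡∅ , members , maximal , indX∪B
      where
      open Basis (basis v C)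
      X∩C≡∅ : Disjoint X C
      X∩C≡∅ i i∈X = by-cases (C i) (λ i∈C → ⊥-elim (1≢0 (trans (sym (δ-diag i)) (indX (δ i) δ⊆X (δu≡0 i∈C) i)))) (λ i∉C → i∉C)
        where
        δ⊆X : SupportedOn (δ i) X
        δ⊆X j j∉X = δ-offdiag (λ i≡j → ≡true⇒≢false (subst (λ j → X j ≡ true) i≡j i∈X) j∉X)
        δu≡0 : C i ≡ true → ∀ t → lincomb (δ i) projected t ≡ 0#
        δu≡0 i∈C t = trans (lincomb-δ projected i t) (projected-C i i∈C t)
      indX∪B : Independent v (X ∪ members)
      indX∪B a a⊆X∪B Σav≡0 i = begin
        a i                 ≡⟨ split (X i) (a i) ⟩
        aX i + aB i         ≡⟨ cong₂ _+_ (aX≡0 i) (aB≡0 i) ⟩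
        0# + 0#             ≡⟨ +-identityˡ 0# ⟩
        0#                  ∎
        where
        aX aB : Fin n → Carrier
        aX j = if X j then a j else 0#
        aB j = if X j then 0# else a j
        split : ∀ b x → x ≡ (if b then x else 0#) + (if b then 0# else x)
        split true  x = sym (+-identityʳ x)
        split false x = sym (+-identityˡ x)
        Σav≗ : ∀ k → lincomb a v k ≡ lincomb aX v k + lincomb aB v k
        Σav≗ k = trans (lincomb-cong v (λ j → split (X j) (a j)) k) (lincomb-+ v aX aB k)
        aX⊆X : SupportedOn aX X
        aX⊆X j j∉X rewrite j∉X = refl
        aB⊆B : SupportedOn aB members
        aB⊆B j j∉B with X j in j∈?X
        ... | true  = refl
        ... | false = a⊆X∪B j (trans (cong (_∨ members j) j∈?X) j∉B)
        aBv⊥ : ∀ t → row t ∙ lincomb aB v ≡ 0#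
        aBv⊥ t = annihilator-Span (row t) (kills t) (Span-⊆ ⊆C (lincomb⇒Span aB aB⊆B))
        ΣaXu≡0 : ∀ t → lincomb aX projected t ≡ 0#
        ΣaXu≡0 t = begin
          lincomb aX projected t                                  ≡⟨ lincomb-projected aX t ⟩
          row t ∙ lincomb aX v                                    ≡⟨ solve 2 (λ p q → p := (p :+ q) :- q) refl _ (row t ∙ lincomb aB v) ⟩
          (row t ∙ lincomb aX v + row t ∙ lincomb aB v) - row t ∙ lincomb aB v ≡⟨ cong₂ _-_ (sym (∙-distribʳ (row t) _ _)) (aBv⊥ t) ⟩
          row t ∙ (lincomb aX v +ᵥ lincomb aB v) - 0#             ≡⟨ cong (_- 0#) (∙-congʳ (row t) (λ k → trans (sym (Σav≗ k)) (Σav≡0 k))) ⟩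
          row t ∙ 0ᵥ - 0#                                         ≡⟨ cong (_- 0#) (∙-zeroʳ (row t)) ⟩
          0# - 0#                                                 ≡⟨ solve 0 (con 0ℤ :- con 0ℤ := con 0ℤ) refl ⟩
          0#                                                      ∎
        aX≡0 : ∀ j → aX j ≡ 0#
        aX≡0 = indX aX aX⊆X ΣaXu≡0
        aB≡0 : ∀ j → aB j ≡ 0#
        aB≡0 = independent aB aB⊆B λ k → begin
          lincomb aB v k                       ≡⟨ +-identityˡ _ ⟨
          0# + lincomb aB v k                  ≡⟨ cong (_+ lincomb aB v k) (sym (lincomb-zero v aX≡0 k)) ⟩
          lincomb aX v k + lincomb aB v k      ≡⟨ sym (Σav≗ k) ⟩
          lincomb a v k                        ≡⟨ Σav≡0 k ⟩
          0#                                   ∎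

    contract⇔Independent : ∀ X → contract (Independent v) C X ⇔ Independent projected X
    contract⇔Independent X = mk⇔ contract⇒Independent Independent⇒contract

  module _ {n m K} {v : Fin n → V K} {w : Fin m → V K} {h : Fin n → Fin m}
           (h-injective : ∀ i j → h i ≡ h j → i ≡ j)
           (c : Fin n → Carrier) (c≢0 : ∀ i → c i ≢ 0#) (v≗cw : ∀ i → v i ≗ c i · w (h i)) where

    private
      w≗c⁻¹v : ∀ i → w (h i) ≗ inv (c i) (c≢0 i) · v i
      w≗c⁻¹v i k = trans (sym (inv-cancelˡ (c≢0 i) (w (h i) k))) (cong (inv (c i) (c≢0 i) *_) (sym (v≗cw i k)))

      Span-v⇒w : ∀ {X} i {y} → Span v (X ─ i) y → Span w (image h X ─ h i) y
      Span-v⇒w {X} i = Span-mono gen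
        where
        gen : ∀ j → (X ─ i) j ≡ true → Span w (image h X ─ h i) (v j)
        gen j j∈ with ─-≡true⁻ {X = X} j∈
        ... | j∈X , i≢j = Span-cong (λ k → sym (v≗cw j k))
          (Span-· (c j) (Span-∈ (─-≡true⁺ {X = image h X} (image⁺ h j∈X refl) (i≢j ∘ h-injective i j))))

      Span-w⇒v : ∀ {X} i {y} → Span w (image h X ─ h i) y → Span v (X ─ i) y
      Span-w⇒v {X} i = Span-mono gen
        where
        gen : ∀ e → (image h X ─ h i) e ≡ true → Span v (X ─ i) (w e)
        gen e e∈ with ─-≡true⁻ {X = image h X} e∈
        ... | e∈hX , hi≢e with image⁻ h e∈hX
        ...   | j , j∈X , refl = Span-cong (λ k → sym (w≗c⁻¹v j k))
          (Span-· (inv (c j) (c≢0 j)) (Span-∈ (─-≡true⁺ {X = X} j∈X (hi≢e ∘ cong h))))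

    Independent-rescaled-image : ∀ X → Independent v X ⇔ Independent w (image h X)
    Independent-rescaled-image X = mk⇔
      (λ indX → ∉Span⇒Independent λ e e∈hX e∈span → case image⁻ h e∈hX of λ where
        (i , i∈X , refl) → Independent⇒∉Span indX i i∈X
          (Span-cong (λ k → sym (v≗cw i k)) (Span-· (c i) (Span-w⇒v i e∈span))))
      (λ indhX → ∉Span⇒Independent λ i i∈X i∈span →
        Independent⇒∉Span indhX (h i) (image⁺ h i∈X refl)
          (Span-cong (λ k → sym (w≗c⁻¹v i k)) (Span-· (inv (c i) (c≢0 i)) (Span-v⇒w i i∈span))))

  Independent-image : ∀ {n m K} {v : Fin n → V K} {w : Fin m → V K} {h : Fin n → Fin m} →
    (∀ i j → h i ≡ h j → i ≡ j) → (∀ i → v i ≗ w (h i)) → ∀ X → Independent v X ⇔ Independent w (image h X)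
  Independent-image h-inj v≗w = Independent-rescaled-image h-inj (λ _ → 1#) (λ _ → 1≢0)
    (λ i k → trans (v≗w i k) (sym (*-identityˡ _)))

-- Loops, parallel pairs and simplification of vector configurations

module Simplification (𝔽 : FiniteField) where
  open FiniteField 𝔽 using (Carrier; enum)
  open LinearAlgebra 𝔽

  Nonzero : ∀ {K} → V K → Set
  Nonzero {K} y = Σ (Fin K) λ k → y k ≢ 0#

  Nonzero⇒≢0 : ∀ {K} {y : V K} → Nonzero y → ¬ y ≗ 0ᵥ
  Nonzero⇒≢0 (k , yk≢0) y≗0 = yk≢0 (y≗0 k)

  zero-or-nonzero : ∀ {K} (y : V K) → y ≗ 0ᵥ ⊎ Nonzero y
  zero-or-nonzero {K} y with all? (λ k → y k ≟ 0#)
  ... | yes y≗0 = inj₁ y≗0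
  ... | no y≢0  = inj₂ (¬∀⟶∃¬ K _ (λ k → y k ≟ 0#) y≢0)

  ≢0⇒Nonzero : ∀ {K} {y : V K} → ¬ y ≗ 0ᵥ → Nonzero y
  ≢0⇒Nonzero {y = y} y≢0 = [ ⊥-elim ∘ y≢0 , id ]′ (zero-or-nonzero y)

  Proportional : ∀ {K} → V K → V K → Set
  Proportional x y = Σ Carrier λ c → x ≗ c · y

  module _ {K : ℕ} where

    proportional-≢0 : ∀ {x y : V K} {c} → Nonzero x → x ≗ c · y → c ≢ 0#
    proportional-≢0 (k , xk≢0) x≗cy c≡0 = xk≢0 (trans (x≗cy k) (trans (cong (_* _) c≡0) (zeroˡ _)))

    proportional-refl : (x : V K) → Proportional x x
    proportional-refl x = 1# , λ k → sym (*-identityˡ (x k))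

    proportional-sym : ∀ {x y : V K} → Nonzero x → Proportional x y → Proportional y x
    proportional-sym {y = y} x≢0 (c , x≗cy) = inv c c≢0 , λ k → sym (trans (cong (inv c c≢0 *_) (x≗cy k)) (inv-cancelˡ c≢0 (y k)))
      where c≢0 = proportional-≢0 x≢0 x≗cy

    proportional-trans : ∀ {x y z : V K} → Proportional x y → Proportional y z → Proportional x z
    proportional-trans (c , x≗cy) (d , y≗dz) = c * d , λ k → trans (x≗cy k) (trans (cong (c *_) (y≗dz k)) (sym (*-assoc _ _ _)))

    Proportional? : (x y : V K) → Dec (Proportional x y)
    Proportional? x y with any? (λ a → all? (λ k → x k ≟ Inverse.to enum a * y k))
    ... | yes (a , x≗ay) = yes (Inverse.to enum a , x≗ay)
    ... | no ∄a = no λ (c , x≗cy) → ∄a (Inverse.from enum c ,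
      λ k → trans (x≗cy k) (cong (_* y k) (sym (Inverse.strictlyInverseˡ enum c))))

  module _ {n K : ℕ} (u : Fin n → V K) where

    ParallelVectors : Fin n → Fin n → Set
    ParallelVectors e e′ = e ≢ e′ × Nonzero (u e) × Nonzero (u e′) × Proportional (u e) (u e′)

    Nonzero⇒Independent-⁅⁆ : ∀ {e} → Nonzero (u e) → Independent u ⁅ e ⁆
    Nonzero⇒Independent-⁅⁆ {e} ue≢0 = ∉Span⇒Independent λ i i∈ i∈span → case-on (∈⁅⁆⁻ i∈) i∈span
      where
      case-on : ∀ {i} → e ≡ i → ¬ Span u (⁅ e ⁆ ─ i) (u i)
      case-on refl ue∈span = Nonzero⇒≢0 ue≢0 (Span-∅ (λ j → ∅ j) ue∈span)
        where
        ∅ : ∀ j → (⁅ e ⁆ ─ e) j ≡ false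
        ∅ j with e ≟ᶠ j
        ... | yes _ = refl
        ... | no _  = refl

    Independent-⁅⁆⇒Nonzero : ∀ {e} → Independent u ⁅ e ⁆ → Nonzero (u e)
    Independent-⁅⁆⇒Nonzero {e} ind = ≢0⇒Nonzero λ ue≗0 →
      1≢0 (trans (sym (δ-diag e)) (ind (δ e) (λ j j∉ → δ-offdiag (∉⁅⁆⁻ j∉)) (λ t → trans (lincomb-δ u e t) (ue≗0 t)) e))

    Parallel⇒ParallelVectors : ∀ {e e′} → Parallel (Independent u) e e′ → ParallelVectors e e′
    Parallel⇒ParallelVectors {e} {e′} (e≢e′ , ind-e , ind-e′ , dep) =
      e≢e′ , Independent-⁅⁆⇒Nonzero ind-e , Independent-⁅⁆⇒Nonzero ind-e′ , proportional
      where
      proportional : Proportional (u e) (u e′)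
      proportional with Span? u ⁅ e′ ⁆ (u e)
      ... | yes ue∈span = Span-⁅⁆ ue∈span
      ... | no ue∉span  = ⊥-elim (dep (Independent-cong pair-comm (Independent-∪⁅⁆ ind-e′ ue∉span)))
        where
        pair-comm : ∀ j → (⁅ e′ ⁆ ∪ ⁅ e ⁆) j ≡ pair e e′ j
        pair-comm j with e ≟ᶠ j | e′ ≟ᶠ j
        ... | yes _ | yes _ = refl
        ... | yes _ | no _  = refl
        ... | no _  | yes _ = refl
        ... | no _  | no _  = refl

    ParallelVectors⇒Parallel : ∀ {e e′} → ParallelVectors e e′ → Parallel (Independent u) e e′
    ParallelVectors⇒Parallel {e} {e′} (e≢e′ , ue≢0 , ue′≢0 , ue∝ue′) =
      e≢e′ , Nonzero⇒Independent-⁅⁆ ue≢0 , Nonzero⇒Independent-⁅⁆ ue′≢0 ,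
      Span⇒¬Independent-∪⁅⁆ (∉⁅⁆⁺ e≢e′) ue′∈span
      where
      ue′∈span : Span u ⁅ e ⁆ (u e′)
      ue′∈span with proportional-sym ue≢0 ue∝ue′
      ... | c , ue′≗cue = Span-cong (λ k → sym (ue′≗cue k)) (Span-· c (Span-∈ (∈⁅⁆⁺ refl)))

  record Representatives {n K} (u : Fin n → V K) : Set where
    field
      count       : ℕ
      pick        : Fin count → Fin n
      injective   : ∀ i j → pick i ≡ pick j → i ≡ j
      nonzero     : ∀ i → Nonzero (u (pick i))
      nonparallel : ∀ i j → ¬ ParallelVectors u (pick i) (pick j)
      covers      : ∀ e → Nonzero (u e) → Σ (Fin count) λ i → pick i ≡ e ⊎ ParallelVectors u e (pick i)

  module _ {n K} {u : Fin (suc n) → V K} where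

    private
      parallel-suc : ∀ {a b} → ParallelVectors (u ∘ suc) a b → ParallelVectors u (suc a) (suc b)
      parallel-suc (a≢b , rest) = a≢b ∘ suc-injective , rest

      parallel-suc⁻ : ∀ {a b} → ParallelVectors u (suc a) (suc b) → ParallelVectors (u ∘ suc) a b
      parallel-suc⁻ (a≢b , rest) = a≢b ∘ cong suc , rest

    representatives-skip-zero : (R : Representatives (u ∘ suc)) → let open Representatives R in
      (Nonzero (u zero) → Σ (Fin count) λ i → ParallelVectors u zero (suc (pick i))) → Representatives u
    representatives-skip-zero R zero-covered = record
      { count = count ; pick = suc ∘ pick
      ; injective = λ i j → injective i j ∘ suc-injective
      ; nonzero = nonzero
      ; nonparallel = λ i j → nonparallel i j ∘ parallel-suc⁻
      ; covers = covers′ }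
      where
      open Representatives R
      covers′ : ∀ e → Nonzero (u e) → Σ (Fin count) λ i → suc (pick i) ≡ e ⊎ ParallelVectors u e (suc (pick i))
      covers′ zero    ue≢0 = map₂ inj₂ (zero-covered ue≢0)
      covers′ (suc e) ue≢0 = map₂ (Sum.map (cong suc) parallel-suc) (covers e ue≢0)

    representatives-add-zero : (R : Representatives (u ∘ suc)) → let open Representatives R in
      Nonzero (u zero) → (∀ i → ¬ Proportional (u zero) (u (suc (pick i)))) → Representatives u
    representatives-add-zero R u₀≢0 u₀∦ = record
      { count = suc count ; pick = pick′ ; injective = injective′ ; nonzero = nonzero′
      ; nonparallel = nonparallel′ ; covers = covers′ }
      where
      open Representatives R
      pick′ : Fin (suc count) → Fin (suc n)
      pick′ zero    = zero
      pick′ (suc i) = suc (pick i)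
      injective′ : ∀ i j → pick′ i ≡ pick′ j → i ≡ j
      injective′ zero    zero    _ = refl
      injective′ (suc i) (suc j) p = cong suc (injective i j (suc-injective p))
      nonzero′ : ∀ i → Nonzero (u (pick′ i))
      nonzero′ zero    = u₀≢0
      nonzero′ (suc i) = nonzero i
      nonparallel′ : ∀ i j → ¬ ParallelVectors u (pick′ i) (pick′ j)
      nonparallel′ zero    zero    (0≢0 , _)          = 0≢0 refl
      nonparallel′ zero    (suc j) (_ , _ , _ , u₀∝)   = u₀∦ j u₀∝
      nonparallel′ (suc i) zero    (_ , ui≢0 , _ , ∝u₀) = u₀∦ i (proportional-sym ui≢0 ∝u₀)
      nonparallel′ (suc i) (suc j) p                   = nonparallel i j (parallel-suc⁻ p)
      covers′ : ∀ e → Nonzero (u e) → Σ (Fin (suc count)) λ i → pick′ i ≡ e ⊎ ParallelVectors u e (pick′ i)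
      covers′ zero    _    = zero , inj₁ refl
      covers′ (suc e) ue≢0 with covers e ue≢0
      ... | i , cover = suc i , Sum.map (cong suc) parallel-suc cover

  representatives : ∀ {n K} (u : Fin n → V K) → Representatives u
  representatives {zero}  u = record
    { count = 0 ; pick = λ () ; injective = λ () ; nonzero = λ () ; nonparallel = λ () ; covers = λ () }
  representatives {suc n} u with representatives (u ∘ suc) | zero-or-nonzero (u zero)
  ... | R | inj₁ u₀≗0 = representatives-skip-zero R λ u₀≢0 → ⊥-elim (Nonzero⇒≢0 u₀≢0 u₀≗0)
  ... | R | inj₂ u₀≢0 with any? (λ i → Proportional? (u zero) (u (suc (Representatives.pick R i))))
  ...   | yes (i , u₀∝) = representatives-skip-zero R λ _ → i , (λ ()) , u₀≢0 , Representatives.nonzero R i , u₀∝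
  ...   | no ∄i        = representatives-add-zero R u₀≢0 (λ i u₀∝ → ∄i (i , u₀∝))

  record VectorSimplification {n K m} (u : Fin n → V K) (S : Sub n) (N : IndSys m) (f : Fin m → Fin n) : Set where
    field
      injective   : ∀ i j → f i ≡ f j → i ≡ j
      ≅image      : ∀ I → N I ⇔ Independent u (image f I)
      ⊆S          : ∀ i → S (f i) ≡ true
      nonzero     : ∀ i → Nonzero (u (f i))
      nonparallel : ∀ i j → ¬ ParallelVectors u (f i) (f j)
      covers      : ∀ e → S e ≡ true → Nonzero (u e) → Σ (Fin m) λ i → f i ≡ e ⊎ ParallelVectors u e (f i)

  module _ {n K m} {M : IndSys n} (u : Fin n → V K) (M⇔u : ∀ X → M X ⇔ Independent u X)
           {S : Sub n} {N : IndSys m} {f : Fin m → Fin n} where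

    private
      to : ∀ {X} → M X → Independent u X
      to = Equivalence.to (M⇔u _)
      from : ∀ {X} → Independent u X → M X
      from = Equivalence.from (M⇔u _)

      ¬Loop⇒Nonzero : ∀ {e} → ¬ Loop M e → Nonzero (u e)
      ¬Loop⇒Nonzero {e} ¬loop = ≢0⇒Nonzero λ ue≗0 → ¬loop λ Me → Nonzero⇒≢0 (Independent-⁅⁆⇒Nonzero u (to Me)) ue≗0

      Nonzero⇒¬Loop : ∀ {e} → Nonzero (u e) → ¬ Loop M e
      Nonzero⇒¬Loop ue≢0 loop = loop (from (Nonzero⇒Independent-⁅⁆ u ue≢0))

      Parallel⇒ : ∀ {e e′} → Parallel M e e′ → ParallelVectors u e e′
      Parallel⇒ (e≢e′ , Me , Me′ , ¬Mee′) = Parallel⇒ParallelVectors u (e≢e′ , to Me , to Me′ , λ ind → ¬Mee′ (from ind))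

      Parallel⇐ : ∀ {e e′} → ParallelVectors u e e′ → Parallel M e e′
      Parallel⇐ p =
        let e≢e′ , ind , ind′ , dep = ParallelVectors⇒Parallel u p in
        e≢e′ , from ind , from ind′ , λ Mee′ → dep (to Mee′)

    simplification⇒vector : IsoToSimplificationOn M S N f → VectorSimplification u S N f
    simplification⇒vector ((inj , N⇔M) , ⊆S , ¬loop , ∦ , covers) = record
      { injective   = inj
      ; ≅image      = λ I → mk⇔ (λ NI → to (Equivalence.to (N⇔M I) NI)) (λ ind → Equivalence.from (N⇔M I) (from ind))
      ; ⊆S          = ⊆S
      ; nonzero     = λ i → ¬Loop⇒Nonzero (¬loop i)
      ; nonparallel = λ i j p → ∦ i j (Parallel⇐ p)
      ; covers      = λ e e∈S ue≢0 → map₂ (Sum.map₂ Parallel⇒) (covers e e∈S (Nonzero⇒¬Loop ue≢0)) }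

    vector⇒simplification : VectorSimplification u S N f → IsoToSimplificationOn M S N f
    vector⇒simplification s =
      (injective , λ I → mk⇔ (λ NI → from (Equivalence.to (≅image I) NI)) (λ MI → Equivalence.from (≅image I) (to MI))) ,
      ⊆S , (λ i → Nonzero⇒¬Loop (nonzero i)) , (λ i j p → nonparallel i j (Parallel⇒ p)) ,
      λ e e∈S ¬loop → map₂ (Sum.map₂ Parallel⇐) (covers e e∈S (¬Loop⇒Nonzero ¬loop))
      where open VectorSimplification s

  -- A simplification only sees the nonzero vectors up to scaling: it can be moved along a
  -- relabelling π of them, and is isomorphic to any simple family with the same lines.
  module _ {n n₀ K m} {u : Fin n → V K} {u₀ : Fin n₀ → V K} {S : Sub n} {S₀ : Sub n₀}
           {N : IndSys m} {f : Fin m → Fin n}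
           (π : ∀ e → Nonzero (u e) → Fin n₀) (u≗u₀∘π : ∀ e ue≢0 → u e ≗ u₀ (π e ue≢0))
           (section : ∀ i → Nonzero (u₀ i) → Σ (Fin n) λ e → S e ≡ true × u e ≗ u₀ i)
           (S₀-nonzero : ∀ i → Nonzero (u₀ i) → S₀ i ≡ true)
           (s : VectorSimplification u S N f) where
    open VectorSimplification s

    private
      f₀ : Fin m → Fin n₀
      f₀ j = π (f j) (nonzero j)

      uf≗u₀f₀ : ∀ j → u (f j) ≗ u₀ (f₀ j)
      uf≗u₀f₀ j = u≗u₀∘π (f j) (nonzero j)

      nonzero₀ : ∀ j → Nonzero (u₀ (f₀ j))
      nonzero₀ j = let k , ufjk≢0 = nonzero j in k , λ u₀f₀jk≡0 → ufjk≢0 (trans (uf≗u₀f₀ j k) u₀f₀jk≡0)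

      proportional⇒ : ∀ {i j} → Proportional (u₀ (f₀ i)) (u₀ (f₀ j)) → Proportional (u (f i)) (u (f j))
      proportional⇒ {i} {j} (c , eq) = c , λ k → trans (uf≗u₀f₀ i k) (trans (eq k) (cong (c *_) (sym (uf≗u₀f₀ j k))))

      injective₀ : ∀ i j → f₀ i ≡ f₀ j → i ≡ j
      injective₀ i j f₀i≡f₀j with i ≟ᶠ j
      ... | yes i≡j = i≡j
      ... | no i≢j  = ⊥-elim (nonparallel i j (i≢j ∘ injective i j , nonzero i , nonzero j ,
                        proportional⇒ (1# , λ k → trans (cong (λ e → u₀ e k) f₀i≡f₀j) (sym (*-identityˡ _)))))

      covers₀ : ∀ e → S₀ e ≡ true → Nonzero (u₀ e) → Σ (Fin m) λ i → f₀ i ≡ e ⊎ ParallelVectors u₀ e (f₀ i)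
      covers₀ e _ u₀e≢0 with section e u₀e≢0
      ... | e′ , e′∈S , ue′≗u₀e with covers e′ e′∈S (let k , u₀ek≢0 = u₀e≢0 in k , λ ue′k≡0 → u₀ek≢0 (trans (sym (ue′≗u₀e k)) ue′k≡0))
      ...   | i , cover with f₀ i ≟ᶠ e
      ...     | yes f₀i≡e = i , inj₁ f₀i≡e
      ...     | no f₀i≢e  = i , inj₂ ((λ e≡f₀i → f₀i≢e (sym e≡f₀i)) , u₀e≢0 , nonzero₀ i , proportional cover)
        where
        proportional : f i ≡ e′ ⊎ ParallelVectors u e′ (f i) → Proportional (u₀ e) (u₀ (f₀ i))
        proportional (inj₁ refl) = 1# , λ k → trans (sym (ue′≗u₀e k)) (trans (uf≗u₀f₀ i k) (sym (*-identityˡ _)))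
        proportional (inj₂ (_ , _ , _ , c , ue′≗cufi)) =
          c , λ k → trans (sym (ue′≗u₀e k)) (trans (ue′≗cufi k) (cong (c *_) (uf≗u₀f₀ i k)))

    simplification-along : VectorSimplification u₀ S₀ N f₀
    simplification-along = record
      { injective   = injective₀
      ; ≅image      = λ I → Independent-image injective₀ uf≗u₀f₀ I ⇔-∘ (⇔-sym (Independent-image injective (λ _ _ → refl) I) ⇔-∘ ≅image I)
      ; ⊆S          = λ j → S₀-nonzero (f₀ j) (nonzero₀ j)
      ; nonzero     = nonzero₀
      ; nonparallel = λ i j (f₀i≢f₀j , _ , _ , prop) →
          nonparallel i j (f₀i≢f₀j ∘ cong f₀ ∘ injective i j , nonzero i , nonzero j , proportional⇒ prop)
      ; covers      = covers₀ }

  module _ {n K m m′} {u : Fin n → V K} {S : Sub n} {N : IndSys m} {f : Fin m → Fin n}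
           (s : VectorSimplification u S N f) {w : Fin m′ → V K}
           (w-distinct : ∀ t t′ → Proportional (w t) (w t′) → t ≡ t′)
           (locate : ∀ e → Nonzero (u e) → Σ (Fin m′) λ t → Σ Carrier λ c → c ≢ 0# × u e ≗ c · w t)
           (realize : ∀ t → Σ (Fin n) λ e → S e ≡ true × Nonzero (u e) × Proportional (u e) (w t)) where
    open VectorSimplification s

    private
      located : Fin m → Fin m′
      located j = proj₁ (locate (f j) (nonzero j))

      scale : Fin m → Carrier
      scale j = proj₁ (proj₂ (locate (f j) (nonzero j)))

      scale≢0 : ∀ j → scale j ≢ 0#
      scale≢0 j = proj₁ (proj₂ (proj₂ (locate (f j) (nonzero j))))

      uf≗scale·w : ∀ j → u (f j) ≗ scale j · w (located j)
      uf≗scale·w j = proj₂ (proj₂ (proj₂ (locate (f j) (nonzero j))))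

      w-located∝uf : ∀ j → Proportional (w (located j)) (u (f j))
      w-located∝uf j = proportional-sym (nonzero j) (scale j , uf≗scale·w j)

      representative : ∀ t → Σ (Fin m) λ j → Proportional (u (f j)) (w t)
      representative t with realize t
      ... | e , e∈S , ue≢0 , ue∝wt with covers e e∈S ue≢0
      ...   | j , inj₁ refl = j , ue∝wt
      ...   | j , inj₂ (_ , _ , _ , ue∝ufj) = j , proportional-trans (proportional-sym ue≢0 ue∝ufj) ue∝wt

      located-representative : ∀ t → located (proj₁ (representative t)) ≡ t
      located-representative t = let j , ufj∝wt = representative t in
        w-distinct _ t (proportional-trans (w-located∝uf j) ufj∝wt)

      representative-located : ∀ j → proj₁ (representative (located j)) ≡ j
      representative-located j with representative (located j)
      ... | j′ , ufj′∝w with j′ ≟ᶠ j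
      ...   | yes j′≡j = j′≡j
      ...   | no j′≢j  = ⊥-elim (nonparallel j′ j (j′≢j ∘ injective j′ j , nonzero j′ , nonzero j ,
                                  proportional-trans ufj′∝w (w-located∝uf j)))

      located-injective : ∀ i j → located i ≡ located j → i ≡ j
      located-injective i j eq = trans (sym (representative-located i)) (trans (cong (proj₁ ∘ representative) eq) (representative-located j))

      image-located : ∀ I → image located (I ∘ located) ≗ I
      image-located I t = ≡true-ext
        (λ t∈ → let j , j∈ , located-j≡t = image⁻ located t∈ in subst (λ t → I t ≡ true) located-j≡t j∈)
        (λ t∈I → image⁺ located (subst (λ t → I t ≡ true) (sym (located-representative t)) t∈I) (located-representative t))

    simplification-≅ : Σ (Fin m′ ↔ Fin m) λ σ → Independent w ≅⟨ σ ⟩ N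
    simplification-≅ = mk↔ₛ′ (proj₁ ∘ representative) located representative-located located-representative , λ I →
      ⇔-sym (mk⇔ (Independent-cong (image-located I)) (Independent-cong (sym ∘ image-located I))
        ⇔-∘ (Independent-rescaled-image located-injective scale scale≢0 uf≗scale·w (I ∘ located)
        ⇔-∘ (⇔-sym (Independent-image injective (λ _ _ → refl) (I ∘ located)) ⇔-∘ ≅image (I ∘ located))))

-- Cones

module Coning (𝔽 : FiniteField) where
  open FiniteField 𝔽 using (Carrier; size; enum)
  open LinearAlgebra 𝔽
  open Simplification 𝔽

  -- extend (from the definitions) appends the new coordinate at the end; _∷ʳ_ does the same
  -- for vectors over any type, as needed for families of rows.
  infixl 6 _∷ʳ_
  _∷ʳ_ : ∀ {A : Set} {r} → Vector A r → A → Vector A (suc r)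
  _∷ʳ_ {r = zero}  x a zero    = a
  _∷ʳ_ {r = suc r} x a zero    = x zero
  _∷ʳ_ {r = suc r} x a (suc k) = (x ∘ suc ∷ʳ a) k

  extend≗∷ʳ : ∀ {r} (x : V r) (a : Carrier) → extend 𝔽 x a ≗ x ∷ʳ a
  extend≗∷ʳ {zero}  x a zero    = refl
  extend≗∷ʳ {suc r} x a zero    = refl
  extend≗∷ʳ {suc r} x a (suc k) = extend≗∷ʳ (x ∘ suc) a k

  map-∷ʳ : ∀ {A B : Set} {r} (g : A → B) (x : Vector A r) (a : A) → map g (x ∷ʳ a) ≗ map g x ∷ʳ g a
  map-∷ʳ {r = zero}  g x a zero    = refl
  map-∷ʳ {r = suc r} g x a zero    = refl
  map-∷ʳ {r = suc r} g x a (suc k) = map-∷ʳ g (x ∘ suc) a k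

  init-∷ʳ : ∀ {A : Set} {r} (x : Vector A r) (a : A) → init (x ∷ʳ a) ≗ x
  init-∷ʳ {r = suc r} x a zero    = refl
  init-∷ʳ {r = suc r} x a (suc k) = init-∷ʳ (x ∘ suc) a k

  last-∷ʳ : ∀ {A : Set} {r} (x : Vector A r) (a : A) → last (x ∷ʳ a) ≡ a
  last-∷ʳ {r = zero}  x a = refl
  last-∷ʳ {r = suc r} x a = last-∷ʳ (x ∘ suc) a

  init-∷ʳ-last : ∀ {A : Set} {r} (y : Vector A (suc r)) → y ≗ init y ∷ʳ last y
  init-∷ʳ-last {r = zero}  y zero    = refl
  init-∷ʳ-last {r = suc r} y zero    = refl
  init-∷ʳ-last {r = suc r} y (suc k) = init-∷ʳ-last (y ∘ suc) k

  ∷ʳ-cong : ∀ {A : Set} {r} {x x′ : Vector A r} {a a′ : A} → x ≗ x′ → a ≡ a′ → x ∷ʳ a ≗ x′ ∷ʳ a′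
  ∷ʳ-cong {r = zero}  x≗x′ a≡a′ zero    = a≡a′
  ∷ʳ-cong {r = suc r} x≗x′ a≡a′ zero    = x≗x′ zero
  ∷ʳ-cong {r = suc r} x≗x′ a≡a′ (suc k) = ∷ʳ-cong (x≗x′ ∘ suc) a≡a′ k

  ∷ʳ-injective : ∀ {A : Set} {r} {x y : Vector A r} {a b : A} → x ∷ʳ a ≗ y ∷ʳ b → x ≗ y × a ≡ b
  ∷ʳ-injective {r = r} {x} {y} {a} {b} eq =
    (λ k → trans (sym (init-∷ʳ x a k)) (trans (eq (inject₁ k)) (init-∷ʳ y b k))) ,
    trans (sym (last-∷ʳ x a)) (trans (eq (fromℕ r)) (last-∷ʳ y b))

  ∷ʳ-+ᵥ : ∀ {r} (x y : V r) (a b : Carrier) → (x +ᵥ y) ∷ʳ (a + b) ≗ (x ∷ʳ a) +ᵥ (y ∷ʳ b)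
  ∷ʳ-+ᵥ {r = zero}  x y a b zero    = refl
  ∷ʳ-+ᵥ {r = suc r} x y a b zero    = refl
  ∷ʳ-+ᵥ {r = suc r} x y a b (suc k) = ∷ʳ-+ᵥ (x ∘ suc) (y ∘ suc) a b k

  ∷ʳ-· : ∀ {r} (c : Carrier) (x : V r) (a : Carrier) → (c · x) ∷ʳ (c * a) ≗ c · (x ∷ʳ a)
  ∷ʳ-· {r = zero}  c x a zero    = refl
  ∷ʳ-· {r = suc r} c x a zero    = refl
  ∷ʳ-· {r = suc r} c x a (suc k) = ∷ʳ-· c (x ∘ suc) a k

  0ᵥ∷ʳ0 : ∀ {r} → 0ᵥ ∷ʳ 0# ≗ 0ᵥ {suc r}
  0ᵥ∷ʳ0 {r = zero}  zero    = refl
  0ᵥ∷ʳ0 {r = suc r} zero    = refl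
  0ᵥ∷ʳ0 {r = suc r} (suc k) = 0ᵥ∷ʳ0 {r} k

  ∙-∷ʳ : ∀ {r} (φ : V r) (c : Carrier) (y : V r) (a : Carrier) → (φ ∷ʳ c) ∙ (y ∷ʳ a) ≡ φ ∙ y + c * a
  ∙-∷ʳ {r = zero}  φ c y a = +-comm _ _
  ∙-∷ʳ {r = suc r} φ c y a =
    trans (cong (φ zero * y zero +_) (∙-∷ʳ (φ ∘ suc) c (y ∘ suc) a)) (sym (+-assoc _ _ _))

  unitLast≗ : ∀ {r} → unitLast 𝔽 r ≗ 0ᵥ ∷ʳ 1#
  unitLast≗ {r = zero}  zero    = refl
  unitLast≗ {r = suc r} zero    = refl
  unitLast≗ {r = suc r} (suc k) = unitLast≗ {r} k

  ∷ʳ-+-tip : ∀ {r} (y : V r) (s t : Carrier) → y ∷ʳ (s + t) ≗ (y ∷ʳ s) +ᵥ t · (0ᵥ ∷ʳ 1#)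
  ∷ʳ-+-tip y s t k = begin
    (y ∷ʳ (s + t)) k
      ≡⟨ ∷ʳ-cong (λ k → sym (trans (cong (y k +_) (zeroʳ t)) (+-identityʳ _))) (cong (s +_) (sym (*-identityʳ t))) k ⟩
    ((y +ᵥ t · 0ᵥ) ∷ʳ (s + t * 1#)) k  ≡⟨ ∷ʳ-+ᵥ y (t · 0ᵥ) s (t * 1#) k ⟩
    (y ∷ʳ s) k + (t · 0ᵥ ∷ʳ t * 1#) k  ≡⟨ cong ((y ∷ʳ s) k +_) (∷ʳ-· t 0ᵥ 1# k) ⟩
    (y ∷ʳ s) k + t * (0ᵥ ∷ʳ 1#) k      ∎
    where open ≡-Reasoning

  scalar : Fin size → Carrier
  scalar = Inverse.to enum

  index : Carrier → Fin size
  index = Inverse.from enum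

  scalar-index : ∀ c → scalar (index c) ≡ c
  scalar-index = Inverse.strictlyInverseˡ enum

  module Cone {r n : ℕ} (x : Fin n → V r) where

    v : Fin (suc (n ℕ.* size)) → V (suc r)
    v = vec (coning 𝔽 (config r n x))

    point : Fin n → Fin size → Fin (suc (n ℕ.* size))
    point i a = suc (combine i a)

    v-tip : v zero ≗ 0ᵥ ∷ʳ 1#
    v-tip = unitLast≗

    v-suc : ∀ k → v (suc k) ≡ extend 𝔽 (x (proj₁ (remQuot {n} size k))) (scalar (proj₂ (remQuot {n} size k)))
    v-suc k with remQuot {n} size k
    ... | _ , _ = refl

    v-point : ∀ i a → v (point i a) ≗ x i ∷ʳ scalar a
    v-point i a k = trans
      (cong (λ y → y k) (trans (v-suc (combine i a)) (cong (λ (j , b) → extend 𝔽 (x j) (scalar b)) (remQuot-combine {n} {size} i a))))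
                      (extend≗∷ʳ (x i) (scalar a) k)

    data View : Fin (suc (n ℕ.* size)) → Set where
      is-tip   : View zero
      is-point : ∀ i a → View (point i a)

    view : ∀ t → View t
    view zero    = is-tip
    view (suc k) = subst (View ∘ suc) (combine-remQuot {n} size k) (is-point _ _)

  module _ {K m : ℕ} {w : Fin m → V K} (w≢0 : ∀ i → Nonzero (w i))
           (w-distinct : ∀ i j → Proportional (w i) (w j) → i ≡ j) where
    open Cone w

    cone-nonzero : ∀ t → Nonzero (v t)
    cone-nonzero t with view t
    ... | is-tip       = ≢0⇒Nonzero λ v≗0 → 1≢0 (proj₂ (∷ʳ-injective (λ k → trans (sym (v-tip k)) (trans (v≗0 k) (sym (0ᵥ∷ʳ0 k))))))
    ... | is-point i a = ≢0⇒Nonzero λ v≗0 → Nonzero⇒≢0 (w≢0 i)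
                        (proj₁ (∷ʳ-injective (λ k → trans (sym (v-point i a k)) (trans (v≗0 k) (sym (0ᵥ∷ʳ0 k))))))

    private
      split : ∀ {y z a b c} t t′ → v t ≗ y ∷ʳ a → v t′ ≗ z ∷ʳ b → v t ≗ c · v t′ → y ≗ c · z × a ≡ c * b
      split {z = z} {b = b} {c} _ _ vt≗ vt′≗ vt≗cvt′ = ∷ʳ-injective λ k →
        trans (sym (vt≗ k)) (trans (vt≗cvt′ k) (trans (cong (c *_) (vt′≗ k)) (sym (∷ʳ-· c z b k))))

    cone-distinct : ∀ t t′ → Proportional (v t) (v t′) → t ≡ t′
    cone-distinct t t′ (c , vt≗cvt′) with view t | view t′
    ... | is-tip | is-tip = refl
    ... | is-tip | is-point i a = ⊥-elim (Nonzero⇒≢0 (w≢0 i) λ k → x*y≡0⇒y≡0 c≢0 (sym (0≗cwi k)))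
      where
      0≗cwi = proj₁ (split zero (point i a) v-tip (v-point i a) vt≗cvt′)
      c≢0 : c ≢ 0#
      c≢0 c≡0 = 1≢0 (trans (proj₂ (split zero (point i a) v-tip (v-point i a) vt≗cvt′)) (trans (cong (_* scalar a) c≡0) (zeroˡ _)))
    ... | is-point i a | is-tip =
      ⊥-elim (Nonzero⇒≢0 (w≢0 i) λ k → trans (proj₁ (split (point i a) zero (v-point i a) v-tip vt≗cvt′) k) (zeroʳ c))
    ... | is-point i a | is-point i′ a′
          with w-distinct i i′ (c , proj₁ (split (point i a) (point i′ a′) (v-point i a) (v-point i′ a′) vt≗cvt′))
    ...   | refl = cong (point i) (to-injective enum (trans a≡ca′ (trans (cong (_* scalar a′) c≡1) (*-identityˡ _))))
      where
      wi≗cwi  = proj₁ (split (point i a) (point i a′) (v-point i a) (v-point i a′) vt≗cvt′)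
      a≡ca′   = proj₂ (split (point i a) (point i a′) (v-point i a) (v-point i a′) vt≗cvt′)
      c≡1 : c ≡ 1#
      c≡1 = x≡c*x⇒c≡1 (proj₂ (w≢0 i)) (wi≗cwi (proj₁ (w≢0 i)))

  module ConeContraction {r n : ℕ} (x : Fin n → V r) (C : Sub (suc (n ℕ.* size))) where
    open Cone x

    shadow : Sub n
    shadow = image (quotient {n} size) (C ∘ suc)

    shadow⁺ : ∀ {i a} → C (point i a) ≡ true → shadow i ≡ true
    shadow⁺ {i} {a} p∈C = image⁺ (quotient size) p∈C (cong proj₁ (remQuot-combine {n} {size} i a))

    shadow⁻ : ∀ {i} → shadow i ≡ true → Σ (Fin size) λ a → C (point i a) ≡ true
    shadow⁻ {i} i∈ with image⁻ (quotient {n} size) {I = C ∘ suc} {j = i} i∈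
    ... | k , k∈C , refl = proj₂ (remQuot {n} size k) , subst (λ k → C (suc k) ≡ true) (sym (combine-remQuot {n} size k)) k∈C

    open Annihilator (annihilator r x shadow) using () renaming (rows to K₀; row to ℓ; kills to ℓ-kills; complete to ℓ-complete)
    module P₀ = Projection (annihilator r x shadow)

    u₀ : Fin n → V K₀
    u₀ = P₀.projected

    u₀-≢0⇒∉shadow : ∀ i → Nonzero (u₀ i) → not (shadow i) ≡ true
    u₀-≢0⇒∉shadow i u₀i≢0 = P₀.projected-≢0⇒∉C i (Nonzero⇒≢0 u₀i≢0)

    lifted : Fin K₀ → V (suc r)
    lifted t = ℓ t ∷ʳ 0#

    lifted-∷ʳ : ∀ t (z : V r) a → lifted t ∙ (z ∷ʳ a) ≡ ℓ t ∙ z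
    lifted-∷ʳ t z a = trans (∙-∷ʳ (ℓ t) 0# z a) (solve 2 (λ p a → p :+ con 0ℤ :* a := p) refl (ℓ t ∙ z) a)

    lifted-init : ∀ t y → lifted t ∙ y ≡ ℓ t ∙ init y
    lifted-init t y = trans (∙-congʳ (lifted t) (init-∷ʳ-last y)) (lifted-∷ʳ t (init y) (last y))

    lifted-tip : ∀ t → lifted t ∙ v zero ≡ 0#
    lifted-tip t = trans (∙-congʳ (lifted t) v-tip) (trans (lifted-∷ʳ t 0ᵥ 1#) (∙-zeroʳ (ℓ t)))

    lifted-point : ∀ t i a → lifted t ∙ v (point i a) ≡ u₀ i t
    lifted-point t i a = trans (∙-congʳ (lifted t) (v-point i a)) (lifted-∷ʳ t (x i) (scalar a))

    lifted-kills : ∀ t e → C e ≡ true → lifted t ∙ v e ≡ 0#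
    lifted-kills t e e∈C with view e
    ... | is-tip       = lifted-tip t
    ... | is-point i a = trans (lifted-point t i a) (ℓ-kills t i (shadow⁺ e∈C))

    lift-Span : ∀ {z} → Span x shadow z → Σ Carrier λ s → Span v C (z ∷ʳ s)
    lift-Span (span-0 z≗0) = 0# , span-0 (λ k → trans (∷ʳ-cong z≗0 refl k) (0ᵥ∷ʳ0 k))
    lift-Span {z} (span-step {z = z′} i c i∈shadow sp z≗) with shadow⁻ i∈shadow | lift-Span sp
    ... | a , p∈C | s , sp′ = s + c * scalar a , span-step (point i a) c p∈C sp′ λ k → begin
      (z ∷ʳ (s + c * scalar a)) k                        ≡⟨ ∷ʳ-cong z≗ refl k ⟩
      ((z′ +ᵥ c · x i) ∷ʳ (s + c * scalar a)) k          ≡⟨ ∷ʳ-+ᵥ z′ (c · x i) s (c * scalar a) k ⟩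
      (z′ ∷ʳ s) k + (c · x i ∷ʳ c * scalar a) k          ≡⟨ cong ((z′ ∷ʳ s) k +_) (∷ʳ-· c (x i) (scalar a) k) ⟩
      (z′ ∷ʳ s) k + c * (x i ∷ʳ scalar a) k              ≡⟨ cong (λ w → (z′ ∷ʳ s) k + c * w) (v-point i a k) ⟨
      (z′ ∷ʳ s) k + c * v (point i a) k                  ∎
      where open ≡-Reasoning

    lifted-complete : ∀ y → (∀ t → lifted t ∙ y ≡ 0#) → Σ Carrier λ s → Span v C (init y ∷ʳ s)
    lifted-complete y y⊥ = lift-Span (ℓ-complete (init y) (λ t → trans (sym (lifted-init t y)) (y⊥ t)))

    module TipInSpan (tip∈ : Span v C (v zero)) where

      annihilatorᶜ : Annihilator v C
      annihilatorᶜ = record { rows = K₀ ; row = lifted ; kills = lifted-kills ; complete = complete }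
        where
        complete : ∀ y → (∀ t → lifted t ∙ y ≡ 0#) → Span v C y
        complete y y⊥ with lifted-complete y y⊥
        ... | s , sp = Span-cong y≗ (Span-+ sp (Span-· (last y - s) tip∈))
          where
          y≗ : (init y ∷ʳ s) +ᵥ (last y - s) · v zero ≗ y
          y≗ k = begin
            (init y ∷ʳ s) k + (last y - s) * v zero k         ≡⟨ cong (λ w → (init y ∷ʳ s) k + (last y - s) * w) (v-tip k) ⟩
            (init y ∷ʳ s) k + (last y - s) * (0ᵥ ∷ʳ 1#) k     ≡⟨ ∷ʳ-+-tip (init y) s (last y - s) k ⟨
            (init y ∷ʳ (s + (last y - s))) k                  ≡⟨ ∷ʳ-cong (λ _ → refl) (solve 2 (λ s l → s :+ (l :- s) := l) refl s (last y)) k ⟩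
            (init y ∷ʳ last y) k                              ≡⟨ init-∷ʳ-last y k ⟨
            y k                                               ∎
            where open ≡-Reasoning

      module Pᶜ = Projection annihilatorᶜ

      under : ∀ e → Nonzero (Pᶜ.projected e) → Σ (Fin n) λ i → Pᶜ.projected e ≗ u₀ i
      under e ue≢0 with view e
      ... | is-tip       = ⊥-elim (Nonzero⇒≢0 ue≢0 lifted-tip)
      ... | is-point i a = i , λ t → lifted-point t i a

      contraction : ∀ {d f} → IsoToSimplificationOn (contract (Independent v) C) (not ∘ C) (Ind 𝔽 d) f →
        IsSimpleContraction 𝔽 (config r n x) d
      contraction simp = shadow , _ , vector⇒simplification u₀ P₀.contract⇔Independent
        (simplification-along (λ e → proj₁ ∘ under e) (λ e → proj₂ ∘ under e) section u₀-≢0⇒∉shadow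
          (simplification⇒vector Pᶜ.projected Pᶜ.contract⇔Independent simp))
        where
        section : ∀ i → Nonzero (u₀ i) → Σ (Fin (suc (n ℕ.* size))) λ e → not (C e) ≡ true × Pᶜ.projected e ≗ u₀ i
        section i u₀i≢0 =
          point i (index 0#) ,
          Pᶜ.projected-≢0⇒∉C _ (λ u≗0 → Nonzero⇒≢0 u₀i≢0 (λ t → trans (sym (lifted-point t i _)) (u≗0 t))) ,
          λ t → lifted-point t i _

    tip-functional : ¬ Span v C (v zero) → Σ (V (suc r)) λ ψ → (∀ e → C e ≡ true → ψ ∙ v e ≡ 0#) × ψ ∙ v zero ≡ 1#
    tip-functional tip∉ = c⁻¹ · φ , φ-kills′ , trans (∙-·ˡ φ c⁻¹ (v zero)) (inv-inverseˡ φ-tip≢0)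
      where
      separation = separating-functional v C (v zero) tip∉
      φ = proj₁ separation
      φ-tip≢0 = proj₂ (proj₂ separation)
      c⁻¹ = inv (φ ∙ v zero) φ-tip≢0
      φ-kills′ : ∀ e → C e ≡ true → (c⁻¹ · φ) ∙ v e ≡ 0#
      φ-kills′ e e∈C = trans (∙-·ˡ φ c⁻¹ (v e)) (trans (cong (c⁻¹ *_) (proj₁ (proj₂ separation) e e∈C)) (zeroʳ c⁻¹))

    module TipNotInSpan (ψ : V (suc r)) (ψ-kills : ∀ e → C e ≡ true → ψ ∙ v e ≡ 0#) (ψ-tip : ψ ∙ v zero ≡ 1#) where

      ψ-∷ʳ : ∀ z a → ψ ∙ (z ∷ʳ a) ≡ ψ ∙ (z ∷ʳ 0#) + a
      ψ-∷ʳ z a = begin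
        ψ ∙ (z ∷ʳ a)
          ≡⟨ ∙-congʳ ψ (λ k → trans (∷ʳ-cong (λ _ → refl) (sym (+-identityˡ a)) k) (∷ʳ-+-tip z 0# a k)) ⟩
        ψ ∙ ((z ∷ʳ 0#) +ᵥ a · (0ᵥ ∷ʳ 1#))
          ≡⟨ trans (∙-distribʳ ψ (z ∷ʳ 0#) (a · (0ᵥ ∷ʳ 1#))) (cong (ψ ∙ (z ∷ʳ 0#) +_) (∙-·ʳ ψ a (0ᵥ ∷ʳ 1#))) ⟩
        ψ ∙ (z ∷ʳ 0#) + a * (ψ ∙ (0ᵥ ∷ʳ 1#))
          ≡⟨ cong (λ w → ψ ∙ (z ∷ʳ 0#) + a * w) (trans (∙-congʳ ψ (sym ∘ v-tip)) ψ-tip) ⟩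
        ψ ∙ (z ∷ʳ 0#) + a * 1#
          ≡⟨ cong (ψ ∙ (z ∷ʳ 0#) +_) (*-identityʳ a) ⟩
        ψ ∙ (z ∷ʳ 0#) + a ∎
        where open ≡-Reasoning

      ψ₀ : Fin n → Carrier
      ψ₀ i = ψ ∙ (x i ∷ʳ 0#)

      row-∙ : ∀ y → (λ s → (lifted ∷ʳ ψ) s ∙ y) ≗ (λ t → lifted t ∙ y) ∷ʳ (ψ ∙ y)
      row-∙ y = map-∷ʳ (_∙ y) lifted ψ

      annihilatorᶜ : Annihilator v C
      annihilatorᶜ = record { rows = suc K₀ ; row = lifted ∷ʳ ψ ; kills = kills ; complete = complete }
        where
        kills : ∀ s e → C e ≡ true → (lifted ∷ʳ ψ) s ∙ v e ≡ 0#
        kills s e e∈C = trans (row-∙ (v e) s) (trans (∷ʳ-cong (λ t → lifted-kills t e e∈C) (ψ-kills e e∈C) s) (0ᵥ∷ʳ0 s))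
        complete : ∀ y → (∀ s → (lifted ∷ʳ ψ) s ∙ y ≡ 0#) → Span v C y
        complete y y⊥ = Span-cong (λ k → trans (∷ʳ-cong (λ _ → refl) (sym last≡s) k) (sym (init-∷ʳ-last y k))) sp
          where
          split : (λ t → lifted t ∙ y) ≗ 0ᵥ × ψ ∙ y ≡ 0#
          split = ∷ʳ-injective (λ s → trans (sym (row-∙ y s)) (trans (y⊥ s) (sym (0ᵥ∷ʳ0 s))))
          ψy≡0 = proj₂ split
          s  = proj₁ (lifted-complete y (proj₁ split))
          sp = proj₂ (lifted-complete y (proj₁ split))
          P = ψ ∙ (init y ∷ʳ 0#)
          P+s≡0 : P + s ≡ 0#
          P+s≡0 = trans (sym (ψ-∷ʳ (init y) s)) (annihilator-Span ψ ψ-kills sp)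
          P+last≡0 : P + last y ≡ 0#
          P+last≡0 = trans (sym (ψ-∷ʳ (init y) (last y))) (trans (∙-congʳ ψ (sym ∘ init-∷ʳ-last y)) ψy≡0)
          last≡s : last y ≡ s
          last≡s = begin
            last y              ≡⟨ solve 2 (λ p l → l := (p :+ l) :- p) refl P (last y) ⟩
            (P + last y) - P    ≡⟨ cong (_- P) (trans P+last≡0 (sym P+s≡0)) ⟩
            (P + s) - P         ≡⟨ solve 2 (λ p s → (p :+ s) :- p := s) refl P s ⟩
            s                   ∎
            where open ≡-Reasoning

      module Pᶜ = Projection annihilatorᶜ

      uᶜ-tip : Pᶜ.projected zero ≗ 0ᵥ ∷ʳ 1#
      uᶜ-tip s = trans (row-∙ (v zero) s) (∷ʳ-cong lifted-tip ψ-tip s)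

      uᶜ-point : ∀ i a → Pᶜ.projected (point i a) ≗ u₀ i ∷ʳ (ψ₀ i + scalar a)
      uᶜ-point i a s = trans (row-∙ (v (point i a)) s)
        (∷ʳ-cong (λ t → lifted-point t i a) (trans (∙-congʳ ψ (v-point i a)) (ψ-∷ʳ (x i) (scalar a))) s)

      open Representatives (representatives u₀)

      simplified : Config 𝔽
      simplified = config K₀ count (u₀ ∘ pick)

      simplified-contraction : IsSimpleContraction 𝔽 (config r n x) simplified
      simplified-contraction = shadow , pick , vector⇒simplification u₀ P₀.contract⇔Independent record
        { injective   = injective
        ; ≅image      = Independent-image injective (λ _ _ → refl)
        ; ⊆S          = λ i → u₀-≢0⇒∉shadow (pick i) (nonzero i)
        ; nonzero     = nonzero
        ; nonparallel = nonparallel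
        ; covers      = λ e _ → covers e }

      pick-distinct : ∀ i j → Proportional (u₀ (pick i)) (u₀ (pick j)) → i ≡ j
      pick-distinct i j prop with i ≟ᶠ j
      ... | yes i≡j = i≡j
      ... | no i≢j  = ⊥-elim (nonparallel i j (i≢j ∘ injective i j , nonzero i , nonzero j , prop))

      module E = Cone (u₀ ∘ pick)

      private
        uᶜ = Pᶜ.projected

        ∉C : ∀ e → Nonzero (uᶜ e) → not (C e) ≡ true
        ∉C e ue≢0 = Pᶜ.projected-≢0⇒∉C e (Nonzero⇒≢0 ue≢0)

        Nonzero-≗ : ∀ {K} {y z : V K} → y ≗ z → Nonzero z → Nonzero y
        Nonzero-≗ y≗z (k , zk≢0) = k , λ yk≡0 → zk≢0 (trans (sym (y≗z k)) yk≡0)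

        ≗⇒Proportional : ∀ {K} {y z : V K} → y ≗ z → Proportional y z
        ≗⇒Proportional y≗z = 1# , λ k → trans (y≗z k) (sym (*-identityˡ _))

        0ᵥ∷ʳc : ∀ c → 0ᵥ ∷ʳ c ≗ c · E.v zero
        0ᵥ∷ʳc c k = begin
          (0ᵥ ∷ʳ c) k                ≡⟨ ∷ʳ-cong (λ _ → sym (zeroʳ c)) (sym (*-identityʳ c)) k ⟩
          (c · 0ᵥ ∷ʳ c * 1#) k        ≡⟨ ∷ʳ-· c 0ᵥ 1# k ⟩
          c * (0ᵥ ∷ʳ 1#) k            ≡⟨ cong (c *_) (E.v-tip k) ⟨
          c * E.v zero k              ∎
          where open ≡-Reasoning

      Located : Fin (suc (n ℕ.* size)) → Set
      Located e = Σ (Fin (suc (count ℕ.* size))) λ t → Σ Carrier λ c → c ≢ 0# × uᶜ e ≗ c · E.v t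

      locate-point : ∀ i a → Nonzero (uᶜ (point i a)) → u₀ i ≗ 0ᵥ ⊎ Nonzero (u₀ i) → Located (point i a)
      locate-point i a u≢0 (inj₁ u₀i≗0) = zero , s , s≢0 , λ k → trans (uᶜ-point i a k) (trans (∷ʳ-cong u₀i≗0 refl k) (0ᵥ∷ʳc s k))
        where
        s = ψ₀ i + scalar a
        s≢0 : s ≢ 0#
        s≢0 s≡0 = Nonzero⇒≢0 u≢0 λ k → trans (uᶜ-point i a k) (trans (∷ʳ-cong u₀i≗0 s≡0 k) (0ᵥ∷ʳ0 k))
      locate-point i a u≢0 (inj₂ u₀i≢0) =
        let j , cover = covers i u₀i≢0
            c , u₀i≗c·u₀j = proportional cover
            c≢0 = proportional-≢0 u₀i≢0 u₀i≗c·u₀j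
            s = ψ₀ i + scalar a
        in E.point j (index (inv c c≢0 * s)) , c , c≢0 , λ k → begin
          uᶜ (point i a) k                                      ≡⟨ uᶜ-point i a k ⟩
          (u₀ i ∷ʳ s) k                                          ≡⟨ ∷ʳ-cong u₀i≗c·u₀j (sym (inv-cancelʳ c≢0 s)) k ⟩
          (c · u₀ (pick j) ∷ʳ c * (inv c c≢0 * s)) k             ≡⟨ ∷ʳ-· c (u₀ (pick j)) _ k ⟩
          c * (u₀ (pick j) ∷ʳ inv c c≢0 * s) k                    ≡⟨ cong (c *_) (∷ʳ-cong (λ _ → refl) (sym (scalar-index _)) k) ⟩
          c * (u₀ (pick j) ∷ʳ scalar (index (inv c c≢0 * s))) k   ≡⟨ cong (c *_) (E.v-point j _ k) ⟨
          c * E.v (E.point j (index (inv c c≢0 * s))) k          ∎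
        where
        open ≡-Reasoning
        proportional : ∀ {j} → pick j ≡ i ⊎ ParallelVectors u₀ i (pick j) → Proportional (u₀ i) (u₀ (pick j))
        proportional (inj₁ refl)             = proportional-refl _
        proportional (inj₂ (_ , _ , _ , p)) = p

      locate : ∀ e → Nonzero (uᶜ e) → Located e
      locate e u≢0 with view e
      ... | is-tip       = zero , 1# , 1≢0 , λ k → trans (uᶜ-tip k) (trans (sym (E.v-tip k)) (sym (*-identityˡ _)))
      ... | is-point i a = locate-point i a u≢0 (zero-or-nonzero (u₀ i))

      realize : ∀ t → Σ (Fin (suc (n ℕ.* size))) λ e → not (C e) ≡ true × Nonzero (uᶜ e) × Proportional (uᶜ e) (E.v t)
      realize t with E.view t
      ... | E.is-tip = zero , ∉C zero u≢0 , u≢0 , ≗⇒Proportional uᶜ≗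
        where
        uᶜ≗ : uᶜ zero ≗ E.v zero
        uᶜ≗ k = trans (uᶜ-tip k) (sym (E.v-tip k))
        u≢0 = Nonzero-≗ uᶜ≗ (cone-nonzero {w = u₀ ∘ pick} nonzero pick-distinct zero)
      ... | E.is-point j b = e , ∉C e u≢0 , u≢0 , ≗⇒Proportional uᶜ≗
        where
        e = point (pick j) (index (scalar b - ψ₀ (pick j)))
        uᶜ≗ : uᶜ e ≗ E.v (E.point j b)
        uᶜ≗ k = begin
          uᶜ e k                                                         ≡⟨ uᶜ-point (pick j) _ k ⟩
          (u₀ (pick j) ∷ʳ (ψ₀ (pick j) + scalar (index (scalar b - ψ₀ (pick j))))) k
            ≡⟨ ∷ʳ-cong (λ _ → refl) (trans (cong (ψ₀ (pick j) +_) (scalar-index _))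
                 (solve 2 (λ p b → p :+ (b :- p) := b) refl (ψ₀ (pick j)) (scalar b))) k ⟩
          (u₀ (pick j) ∷ʳ scalar b) k                                    ≡⟨ E.v-point j b k ⟨
          E.v (E.point j b) k                                            ∎
          where open ≡-Reasoning
        u≢0 = Nonzero-≗ uᶜ≗ (cone-nonzero {w = u₀ ∘ pick} nonzero pick-distinct (E.point j b))

      coning-≅ : ∀ {d f} → IsoToSimplificationOn (contract (Independent v) C) (not ∘ C) (Ind 𝔽 d) f →
        Iso 𝔽 (coning 𝔽 simplified) d
      coning-≅ simp = simplification-≅ (simplification⇒vector uᶜ Pᶜ.contract⇔Independent simp)
        (cone-distinct {w = u₀ ∘ pick} nonzero pick-distinct) locate realize

  cone-contraction : ∀ c d → IsSimpleContraction 𝔽 (coning 𝔽 c) d →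
    IsSimpleContraction 𝔽 c d ⊎ Σ (Config 𝔽) λ e → IsSimpleContraction 𝔽 c e × Iso 𝔽 (coning 𝔽 e) d
  cone-contraction (config r n x) d (C , f , simp) with Span? (Cone.v x) C (Cone.v x zero)
  ... | yes tip∈ = inj₁ (TipInSpan.contraction tip∈ simp)
    where open ConeContraction x C
  ... | no tip∉  = inj₂ (simplified , simplified-contraction , coning-≅ simp)
    where
    open ConeContraction x C
    ψ = tip-functional tip∉
    open TipNotInSpan (proj₁ ψ) (proj₁ (proj₂ ψ)) (proj₂ (proj₂ ψ))

module _ {𝔽 : FiniteField} where
  open LinearAlgebra 𝔽 using (Independent-cong)

  IsSimpleContraction-via-Iso : ∀ {c c′ d} → Iso 𝔽 c c′ → IsSimpleContraction 𝔽 c′ d → IsSimpleContraction 𝔽 c d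
  IsSimpleContraction-via-Iso (σ , c≅c′) (C′ , f′ , simp′) =
    C′ ∘ Inverse.to σ , Inverse.from σ ∘ f′ ,
    simplification-transport σ (contract-≅ σ c≅c′ Independent-cong C′) (contract-cong Independent-cong (λ _ → refl)) simp′

lemma3p1 : (𝔽 : FiniteField) (𝓜 : Config 𝔽 → Set) →
    (∀ c → 𝓜 c → Simple 𝔽 c) →
    (∀ c d → 𝓜 c → Iso 𝔽 c d → 𝓜 d) →
    InducedMinorClosed 𝔽 𝓜 →
    ContractionClosed 𝔽 (Hat 𝔽 𝓜)
lemma3p1 𝔽 𝓜 _ _ (_ , 𝓜-contraction-closed) = closed
  where
  open Coning 𝔽 using (cone-contraction)
  closed : ContractionClosed 𝔽 (Hat 𝔽 𝓜)
  closed c d (base 𝓜c) c/d = base (𝓜-contraction-closed c d 𝓜c c/d)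
  closed _ d (cone {c} hc) Ac/d with cone-contraction c d Ac/d
  ... | inj₁ c/d              = closed c d hc c/d
  ... | inj₂ (e , c/e , Ae≅d) = iso (cone (closed c e hc c/e)) Ae≅d
  closed c d (iso {c′} hc′ c′≅c) c/d = closed c′ d hc′ (IsSimpleContraction-via-Iso c′≅c c/d)
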